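{- Let $n\ge6$ be an integer divisible by $3$. Then $$\mathscr{K}\left(B\left(1,\tfrac n3+2,\tfrac n3-1,\tfrac n3-1\right)\right)=\frac1{54}\left[n^3+3n^2+60n-270+\frac{297n^2-729n+5832}{n^3+9n}\right].$$
   Context: The barbell graph $B(1,a,b,c)$ on $a+b+c$ vertices is obtained from a path $P_a$ on $a$ vertices by joining every vertex of a complete graph $K_b$ to one endpoint of the path (forming a clique $K_{b+1}$) and every vertex of a complete graph $K_c$ to the other endpoint (forming a clique $K_{c+1}$). For a connected graph $H$ with $m\ge1$ edges and degrees $d_i$, Kemeny's constant is $\mathscr{K}(H)=\sum_j\pi_jm_{ij}$ for the simple random walk on $H$, where $\pi_j=d_j/2m$ and $m_{ij}$ is the expected hitting time of $j$ from $i$ ($m_{jj}=0$); equivalently $\mathscr{K}(H)=\frac1{4m}\sum_{i,j}d_id_jr_H(i,j)$ with $r_H$ the effective resistance. -}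

module Defs where

open import Data.Nat as ℕ using (ℕ; zero; suc; _∸_; _<ᵇ_; _≡ᵇ_)
open import Data.Bool using (Bool; true; false; if_then_else_; _∧_; _∨_; not)
open import Data.Fin using (Fin; toℕ)
open import Data.Integer using (ℤ; +_)
open import Data.Rational using (ℚ; 0ℚ; 1ℚ; _+_; _*_; _-_; _/_; 1/_; ≢-nonZero)
open import Data.Rational.Properties using (_≟_)
open import Relation.Nullary using (yes; no)
open import Relation.Binary.PropositionalEquality using (_≡_; _≢_)

ℕ→ℚ : ℕ → ℚ
ℕ→ℚ k = (+ k) / 1

-- inverse with the (irrelevant here) convention 1/0 = 0
inv : ℚ → ℚ
inv q with q ≟ 0ℚ
... | yes _ = 0ℚ
... | no q≢0 = 1/_ q {{≢-nonZero q≢0}}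

Σ : (N : ℕ) → (Fin N → ℚ) → ℚ
Σ zero f = 0ℚ
Σ (suc N) f = f Fin.zero + Σ N (λ k → f (Fin.suc k))
  where import Data.Fin as Fin

record Graph (N : ℕ) : Set where
  field
    adj : Fin N → Fin N → Bool

open Graph public

_≤ᵇ'_ : ℕ → ℕ → Bool
x ≤ᵇ' y = x <ᵇ suc y

inRange : ℕ → ℕ → ℕ → Bool
inRange lo hi x = (lo ≤ᵇ' x) ∧ (x <ᵇ hi)

-- Labelling (by toℕ):
--   0 .. b-1          : the clique K_b
--   b .. b+a-1        : the path P_a  (endpoints b and b+a-1)
--   b+a .. b+a+c-1    : the clique K_c
-- K_b is joined completely to path vertex b, K_c completely to path vertex b+a-1.
barbellAdjℕ : ℕ → ℕ → ℕ → ℕ → ℕ → Bool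
barbellAdjℕ a b c i j =
     (not (i ≡ᵇ j) ∧ (i <ᵇ b) ∧ (j <ᵇ b))
  ∨ ((i <ᵇ b) ∧ (j ≡ᵇ b))
  ∨ ((j <ᵇ b) ∧ (i ≡ᵇ b))
  ∨ (inRange b (b ℕ.+ a) i ∧ inRange b (b ℕ.+ a) j
       ∧ ((suc i ≡ᵇ j) ∨ (suc j ≡ᵇ i)))
  ∨ (not (i ≡ᵇ j) ∧ inRange (b ℕ.+ a) (b ℕ.+ a ℕ.+ c) i
       ∧ inRange (b ℕ.+ a) (b ℕ.+ a ℕ.+ c) j)
  ∨ (inRange (b ℕ.+ a) (b ℕ.+ a ℕ.+ c) i ∧ (suc j ≡ᵇ b ℕ.+ a))
  ∨ (inRange (b ℕ.+ a) (b ℕ.+ a ℕ.+ c) j ∧ (suc i ≡ᵇ b ℕ.+ a))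

Barbell : (a b c : ℕ) → Graph (a ℕ.+ b ℕ.+ c)
Barbell a b c = record { adj = λ i j → barbellAdjℕ a b c (toℕ i) (toℕ j) }

indicator : Bool → ℚ
indicator true = 1ℚ
indicator false = 0ℚ

module _ {N : ℕ} (G : Graph N) where

  deg : Fin N → ℚ
  deg i = Σ N (λ k → indicator (adj G i k))

  twiceEdges : ℚ
  twiceEdges = Σ N deg

  π : Fin N → ℚ
  π j = deg j * inv twiceEdges

  -- m is the matrix of expected hitting times of the simple random walk on G:
  -- m_jj = 0, and for i ≠ j, m_ij = 1 + (1/d_i) Σ_{k ~ i} m_kj
  -- (written multiplied through by d_i).
  IsHittingTimes : (Fin N → Fin N → ℚ) → Set
  IsHittingTimes m =
      (∀ j → m j j ≡ 0ℚ)
    × (∀ i j → i ≢ j →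
         deg i * m i j ≡ deg i + Σ N (λ k → indicator (adj G i k) * m k j))
    where open import Data.Product using (_×_)

  kemenyFrom : (Fin N → Fin N → ℚ) → Fin N → ℚ
  kemenyFrom m i = Σ N (λ j → π j * m i j)

-- Let Δ be the graph Laplacian. If ρ is symmetric, vanishes on the diagonal and
-- Δ ρ(·,v) = β − c·[· = v] for some β and some c ≠ 0, then Green's identity applied to
-- ρ(·,j) − ρ(·,i) + ρ(i,j) and to the hitting times m(·,j) gives
-- c·m(i,j) = Σ_u (ρ(u,j) − ρ(u,i) + ρ(i,j)) d_u. Averaging over j with weights d_j/2m the
-- terms depending on i cancel, and K = Σ_{u,j} d_u d_j ρ(u,j) / (2m·c), the resistance
-- formula (ρ is c/2 times the effective resistance). On B(1,a,b,c) the effective resistance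
-- is explicit: 2/(b+1) and 2/(c+1) across the two cliques, the distance along the path.
-- Scaled by κ = (b+1)(c+1), it is checked block by block to satisfy the Laplacian equation,
-- and summing it against the degrees gives K in closed form in a, b, c; Corollary 3.6 is
-- the case a = n/3 + 2, b = c = n/3 − 1.

module Submission where

open import Defs
open import Data.Nat using (ℕ; _≤_; _∸_; _^_)
open import Data.Nat.Divisibility using (_∣_)
open import Data.Nat.DivMod using (_/_)
open import Data.Fin using (Fin)
open import Data.Integer using (ℤ; +_)
open import Data.Rational using (ℚ; _+_; _*_; _-_)
open import Relation.Binary.PropositionalEquality using (_≡_)

import Data.Nat as ℕ
open import Data.Nat using (zero; suc; _<_; s≤s; z≤n; z<s)
import Data.Nat.Properties as ℕP
open import Data.Nat.DivMod using (m/n*n≡m)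
open import Data.Nat.Coprimality using (1-coprimeTo) renaming (sym to coprime-sym)
import Data.Fin as Fin
open import Data.Fin using (toℕ)
import Data.Fin.Properties as FinP
import Data.Integer as ℤ
import Data.Integer.Properties as ℤP
open import Data.Rational using (mkℚ; 0ℚ; 1ℚ; ½; -_; ≢-nonZero)
import Data.Rational.Properties as ℚP
open import Data.Bool using (Bool; true; false; not; _∨_; if_then_else_)
import Data.Bool.Properties as BoolP
open import Data.Product using (_,_)
open import Data.Sum using (inj₁; inj₂)
open import Data.Maybe using (Maybe)
open import Function using (_∘_)
open import Algebra.Bundles using (CommutativeRing)
open import Algebra.Properties.Semiring.Sum (CommutativeRing.semiring ℚP.+-*-commutativeRing)
  using (sum; sum-cong-≗; sum-replicate; ∑-distrib-+; ∑-comm; *-distribˡ-sum; *-distribʳ-sum)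
open import Algebra.Properties.Semiring.Mult (CommutativeRing.semiring ℚP.+-*-commutativeRing)
  using (_×_; ×-homo-+; ×1-homo-*; ×-assoc-*; ×-congʳ)
open import Relation.Binary.PropositionalEquality
  using (_≢_; refl; sym; trans; cong; cong₂; subst; module ≡-Reasoning)
open import Relation.Nullary using (yes; no; contradiction)
open import Relation.Nullary.Decidable using (dec⇒maybe; dec-true; dec-false)
open import Tactic.RingSolver using (solve-∀)
open import Tactic.RingSolver.Core.AlmostCommutativeRing
  using (AlmostCommutativeRing; fromCommutativeRing)

open ≡-Reasoning

-- Rational arithmetic

cong₃ : ∀ {p p′ q q′ r r′ : ℚ} (f : ℚ → ℚ → ℚ → ℚ) → p ≡ p′ → q ≡ q′ → r ≡ r′ → f p q r ≡ f p′ q′ r′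
cong₃ f refl refl refl = refl

ℚ-ring : AlmostCommutativeRing _ _
ℚ-ring = fromCommutativeRing ℚP.+-*-commutativeRing isZero
  where
  isZero : (x : ℚ) → Maybe (0ℚ ≡ x)
  isZero x = dec⇒maybe (0ℚ ℚP.≟ x)

inv-inverseˡ : ∀ {q} → q ≢ 0ℚ → inv q * q ≡ 1ℚ
inv-inverseˡ {q} q≢0 with q ℚP.≟ 0ℚ
... | yes q≡0 = contradiction q≡0 q≢0
... | no q≢0′ = ℚP.*-inverseˡ q {{≢-nonZero q≢0′}}

inv-cross-multiply : ∀ {t c s k x y h} → t ≢ 0ℚ → c ≢ 0ℚ → k ≢ 0ℚ → h ≢ 0ℚ →
  s * (k * h) ≡ t * c * (x * h + y) → inv t * (inv c * s) ≡ inv k * (x + y * inv h)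
inv-cross-multiply {t} {c} {s} {k} {x} {y} {h} t≢0 c≢0 k≢0 h≢0 s*k*h≡t*c*[x*h+y] = begin
  inv t * (inv c * s)
    ≡⟨ x≡x*[1*1] (inv t * (inv c * s)) ⟩
  inv t * (inv c * s) * (1ℚ * 1ℚ)
    ≡⟨ cong₂ (λ p q → inv t * (inv c * s) * (p * q)) (inv-inverseˡ k≢0) (inv-inverseˡ h≢0) ⟨
  inv t * (inv c * s) * ((inv k * k) * (inv h * h))
    ≡⟨ gather (inv t) (inv c) s (inv k) k (inv h) h ⟩
  inv t * inv c * inv k * inv h * (s * (k * h))
    ≡⟨ cong (inv t * inv c * inv k * inv h *_) s*k*h≡t*c*[x*h+y] ⟩
  inv t * inv c * inv k * inv h * (t * c * (x * h + y))
    ≡⟨ regroup (inv t) (inv c) (inv k) (inv h) t c x y h ⟩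
  inv k * ((inv t * t) * (inv c * c) * (x * (inv h * h) + y * inv h))
    ≡⟨ cong₃ (λ p q r → inv k * (p * q * (x * r + y * inv h)))
             (inv-inverseˡ t≢0) (inv-inverseˡ c≢0) (inv-inverseˡ h≢0) ⟩
  inv k * (1ℚ * 1ℚ * (x * 1ℚ + y * inv h))
    ≡⟨ drop-units (inv k) x (y * inv h) ⟩
  inv k * (x + y * inv h) ∎
  where
  x≡x*[1*1] : ∀ x → x ≡ x * (1ℚ * 1ℚ)
  x≡x*[1*1] = solve-∀ ℚ-ring
  gather : ∀ a b s ik k ih h → a * (b * s) * ((ik * k) * (ih * h)) ≡ a * b * ik * ih * (s * (k * h))
  gather = solve-∀ ℚ-ring
  regroup : ∀ it ic ik ih t c x y h →
    it * ic * ik * ih * (t * c * (x * h + y)) ≡ ik * ((it * t) * (ic * c) * (x * (ih * h) + y * ih))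
  regroup = solve-∀ ℚ-ring
  drop-units : ∀ ik x z → ik * (1ℚ * 1ℚ * (x * 1ℚ + z)) ≡ ik * (x + z)
  drop-units = solve-∀ ℚ-ring

ℕ→ℚ≡mkℚ : ∀ n → ℕ→ℚ n ≡ mkℚ (+ n) 0 (coprime-sym (1-coprimeTo n))
ℕ→ℚ≡mkℚ n = ℚP.↥p/↧p≡p (mkℚ (+ n) 0 (coprime-sym (1-coprimeTo n)))

ℕ→ℚ-+ : ∀ m n → ℕ→ℚ (m ℕ.+ n) ≡ ℕ→ℚ m + ℕ→ℚ n
ℕ→ℚ-+ m n rewrite ℕ→ℚ≡mkℚ m | ℕ→ℚ≡mkℚ n =
  sym (ℚP./-cong {p₁ = + m ℤ.* + 1 ℤ.+ + n ℤ.* + 1} {q₁ = 1} m·1+n·1≡m+n refl)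
  where
  m·1+n·1≡m+n : + m ℤ.* + 1 ℤ.+ + n ℤ.* + 1 ≡ + (m ℕ.+ n)
  m·1+n·1≡m+n = trans (cong₂ ℤ._+_ (ℤP.*-identityʳ (+ m)) (ℤP.*-identityʳ (+ n))) (sym (ℤP.pos-+ m n))

ℕ→ℚ-≢0 : ∀ n .{{_ : ℕ.NonZero n}} → ℕ→ℚ n ≢ 0ℚ
ℕ→ℚ-≢0 (suc n) eq with trans (sym (ℕ→ℚ≡mkℚ (suc n))) eq
... | ()

-- Naturals are mapped into ℚ as n × 1ℚ: since suc n × 1ℚ unfolds to 1ℚ + n × 1ℚ, the ring solver
-- sees successors as additions of 1ℚ.
ℕ→ℚ≡×1 : ∀ n → ℕ→ℚ n ≡ n × 1ℚ
ℕ→ℚ≡×1 zero    = refl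
ℕ→ℚ≡×1 (suc n) = trans (ℕ→ℚ-+ 1 n) (cong (λ q → 1ℚ + q) (ℕ→ℚ≡×1 n))

×1-≢0 : ∀ n .{{_ : ℕ.NonZero n}} → n × 1ℚ ≢ 0ℚ
×1-≢0 n = ℕ→ℚ-≢0 n ∘ trans (ℕ→ℚ≡×1 n)

∸×1 : ∀ {s t} → s ≤ t → (t ∸ s) × 1ℚ ≡ t × 1ℚ - s × 1ℚ
∸×1 {s} {t} s≤t = begin
  (t ∸ s) × 1ℚ                        ≡⟨ x≡y+x-y ((t ∸ s) × 1ℚ) (s × 1ℚ) ⟩
  s × 1ℚ + (t ∸ s) × 1ℚ - s × 1ℚ      ≡⟨ cong (λ x → x - s × 1ℚ) (×-homo-+ 1ℚ s (t ∸ s)) ⟨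
  (s ℕ.+ (t ∸ s)) × 1ℚ - s × 1ℚ       ≡⟨ cong (λ n → n × 1ℚ - s × 1ℚ) (ℕP.m+[n∸m]≡n s≤t) ⟩
  t × 1ℚ - s × 1ℚ                     ∎
  where
  x≡y+x-y : ∀ x y → x ≡ y + x - y
  x≡y+x-y = solve-∀ ℚ-ring

∣-∣×1 : ∀ {s t} → s ≤ t → ℕ.∣ t - s ∣ × 1ℚ ≡ t × 1ℚ - s × 1ℚ
∣-∣×1 s≤t = trans (cong (_× 1ℚ) (ℕP.m≤n⇒∣n-m∣≡n∸m s≤t)) (∸×1 s≤t)

∣n-1+n∣×1 : ∀ n → ℕ.∣ n - suc n ∣ × 1ℚ ≡ 1ℚ
∣n-1+n∣×1 zero    = ℚP.+-identityʳ 1ℚ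
∣n-1+n∣×1 (suc n) = ∣n-1+n∣×1 n

∣-∣-secondDifference : ∀ t s → ℕ.∣ suc (suc t) - s ∣ × 1ℚ + ℕ.∣ t - s ∣ × 1ℚ
                              ≡ 2 × 1ℚ * ℕ.∣ suc t - s ∣ × 1ℚ + 2 × 1ℚ * indicator (suc t ℕ.≡ᵇ s)
∣-∣-secondDifference zero    zero          = refl
∣-∣-secondDifference zero    (suc zero)    = refl
∣-∣-secondDifference zero    (suc (suc s)) = identity (s × 1ℚ)
  where
  identity : ∀ S → S + (1ℚ + (1ℚ + S)) ≡ 2 × 1ℚ * (1ℚ + S) + 2 × 1ℚ * 0ℚ
  identity = solve-∀ ℚ-ring
∣-∣-secondDifference (suc t) zero          = identity (t × 1ℚ)
  where
  identity : ∀ T → (1ℚ + (1ℚ + (1ℚ + T))) + (1ℚ + T) ≡ 2 × 1ℚ * (1ℚ + (1ℚ + T)) + 2 × 1ℚ * 0ℚ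
  identity = solve-∀ ℚ-ring
∣-∣-secondDifference (suc t) (suc s)       = ∣-∣-secondDifference t s

<ᵇ-true : ∀ {m n} → m < n → (m ℕ.<ᵇ n) ≡ true
<ᵇ-true {m} {n} = dec-true (m ℕP.<? n)

<ᵇ-false : ∀ {m n} → n ≤ m → (m ℕ.<ᵇ n) ≡ false
<ᵇ-false {m} {n} n≤m = dec-false (m ℕP.<? n) (ℕP.≤⇒≯ n≤m)

≡ᵇ-false : ∀ {m n} → m ≢ n → (m ℕ.≡ᵇ n) ≡ false
≡ᵇ-false {m} {n} = dec-false (m ℕP.≟ n)

≡ᵇ-refl : ∀ m → (m ℕ.≡ᵇ m) ≡ true
≡ᵇ-refl m = dec-true (m ℕP.≟ m) refl

≡ᵇ-sym : ∀ m n → (m ℕ.≡ᵇ n) ≡ (n ℕ.≡ᵇ m)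
≡ᵇ-sym zero    zero    = refl
≡ᵇ-sym zero    (suc n) = refl
≡ᵇ-sym (suc m) zero    = refl
≡ᵇ-sym (suc m) (suc n) = ≡ᵇ-sym m n

+-≡ᵇ-+ : ∀ p {m n} → (p ℕ.+ m ℕ.≡ᵇ p ℕ.+ n) ≡ (m ℕ.≡ᵇ n)
+-≡ᵇ-+ zero    = refl
+-≡ᵇ-+ (suc p) = +-≡ᵇ-+ p

+-≡ᵇ-id : ∀ p {m} → (p ℕ.+ m ℕ.≡ᵇ p) ≡ (m ℕ.≡ᵇ 0)
+-≡ᵇ-id zero    = refl
+-≡ᵇ-id (suc p) = +-≡ᵇ-id p

suc+-≡ᵇ-+ : ∀ p {m n} → (suc (p ℕ.+ m) ℕ.≡ᵇ p ℕ.+ n) ≡ (suc m ℕ.≡ᵇ n)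
suc+-≡ᵇ-+ zero    = refl
suc+-≡ᵇ-+ (suc p) = suc+-≡ᵇ-+ p

indicator-not : ∀ p x → indicator (not p) * x ≡ x - indicator p * x
indicator-not true  x = 0*x≡x-1*x x
  where
  0*x≡x-1*x : ∀ x → 0ℚ * x ≡ x - 1ℚ * x
  0*x≡x-1*x = solve-∀ ℚ-ring
indicator-not false x = 1*x≡x-0*x x
  where
  1*x≡x-0*x : ∀ x → 1ℚ * x ≡ x - 0ℚ * x
  1*x≡x-0*x = solve-∀ ℚ-ring

indicator-adjacent : ∀ t s → indicator ((suc t ℕ.≡ᵇ s) ∨ (suc s ℕ.≡ᵇ t))
                           ≡ indicator (s ℕ.≡ᵇ suc t) + indicator (suc s ℕ.≡ᵇ t)
indicator-adjacent zero    zero          = refl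
indicator-adjacent zero    (suc zero)    = refl
indicator-adjacent zero    (suc (suc s)) = refl
indicator-adjacent (suc zero)    zero    = refl
indicator-adjacent (suc (suc t)) zero    = refl
indicator-adjacent (suc t) (suc s)       = indicator-adjacent t s

m≤n⇒n<m+o⇒n∸m<o : ∀ {m n o} → m ≤ n → n < m ℕ.+ o → n ∸ m < o
m≤n⇒n<m+o⇒n∸m<o {m} m≤n n<m+o = ℕP.+-cancelˡ-< m _ _ (subst (_< m ℕ.+ _) (sym (ℕP.m+[n∸m]≡n m≤n)) n<m+o)

-- Finite sums

Σ≡sum : ∀ N (f : Fin N → ℚ) → Σ N f ≡ sum f
Σ≡sum zero    f = refl
Σ≡sum (suc N) f = cong (λ s → f Fin.zero + s) (Σ≡sum N (λ k → f (Fin.suc k)))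

Σ-cong : ∀ N {f g : Fin N → ℚ} → (∀ k → f k ≡ g k) → Σ N f ≡ Σ N g
Σ-cong N {f} {g} f≗g = begin
  Σ N f    ≡⟨ Σ≡sum N f ⟩
  sum f    ≡⟨ sum-cong-≗ f≗g ⟩
  sum g    ≡⟨ Σ≡sum N g ⟨
  Σ N g    ∎

Σ-distrib-+ : ∀ N (f g : Fin N → ℚ) → Σ N (λ k → f k + g k) ≡ Σ N f + Σ N g
Σ-distrib-+ N f g = begin
  Σ N (λ k → f k + g k)   ≡⟨ Σ≡sum N _ ⟩
  sum (λ k → f k + g k)   ≡⟨ ∑-distrib-+ f g ⟩
  sum f + sum g           ≡⟨ cong₂ _+_ (Σ≡sum N f) (Σ≡sum N g) ⟨
  Σ N f + Σ N g           ∎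

*-distribˡ-Σ : ∀ N x (f : Fin N → ℚ) → x * Σ N f ≡ Σ N (λ k → x * f k)
*-distribˡ-Σ N x f = begin
  x * Σ N f               ≡⟨ cong (x *_) (Σ≡sum N f) ⟩
  x * sum f               ≡⟨ *-distribˡ-sum x f ⟩
  sum (λ k → x * f k)     ≡⟨ Σ≡sum N _ ⟨
  Σ N (λ k → x * f k)     ∎

*-distribʳ-Σ : ∀ N x (f : Fin N → ℚ) → Σ N f * x ≡ Σ N (λ k → f k * x)
*-distribʳ-Σ N x f = begin
  Σ N f * x               ≡⟨ cong (_* x) (Σ≡sum N f) ⟩
  sum f * x               ≡⟨ *-distribʳ-sum x f ⟩
  sum (λ k → f k * x)     ≡⟨ Σ≡sum N _ ⟨
  Σ N (λ k → f k * x)     ∎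

Σ-distrib-- : ∀ N (f g : Fin N → ℚ) → Σ N (λ k → f k - g k) ≡ Σ N f - Σ N g
Σ-distrib-- N f g = begin
  Σ N (λ k → f k - g k)                  ≡⟨ Σ-distrib-+ N f (λ k → - g k) ⟩
  Σ N f + Σ N (λ k → - g k)              ≡⟨ cong (λ s → Σ N f + s) (Σ-cong N (λ k → -x≡-1*x (g k))) ⟩
  Σ N f + Σ N (λ k → - 1ℚ * g k)         ≡⟨ cong (λ s → Σ N f + s) (*-distribˡ-Σ N (- 1ℚ) g) ⟨
  Σ N f + - 1ℚ * Σ N g                   ≡⟨ cong (λ s → Σ N f + s) (-x≡-1*x (Σ N g)) ⟨
  Σ N f - Σ N g                          ∎
  where
  -x≡-1*x : ∀ x → - x ≡ - 1ℚ * x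
  -x≡-1*x = solve-∀ ℚ-ring

Σ-comm : ∀ N M (h : Fin N → Fin M → ℚ) →
         Σ N (λ i → Σ M (λ j → h i j)) ≡ Σ M (λ j → Σ N (λ i → h i j))
Σ-comm N M h = begin
  Σ N (λ i → Σ M (h i))                     ≡⟨ Σ-cong N (λ i → Σ≡sum M (h i)) ⟩
  Σ N (λ i → sum (h i))                     ≡⟨ Σ≡sum N _ ⟩
  sum (λ i → sum (h i))                     ≡⟨ ∑-comm h ⟩
  sum (λ j → sum (λ i → h i j))             ≡⟨ Σ≡sum M _ ⟨
  Σ M (λ j → sum (λ i → h i j))             ≡⟨ Σ-cong M (λ j → Σ≡sum N (λ i → h i j)) ⟨
  Σ M (λ j → Σ N (λ i → h i j))             ∎

Σ-zeroˡ : ∀ N (f : Fin N → ℚ) → Σ N (λ k → 0ℚ * f k) ≡ 0ℚ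
Σ-zeroˡ N f = trans (sym (*-distribˡ-Σ N 0ℚ f)) (ℚP.*-zeroˡ (Σ N f))

δ : ∀ {N} → Fin N → Fin N → ℚ
δ u v = indicator (toℕ u ℕ.≡ᵇ toℕ v)

Σ-δ : ∀ N (i : Fin N) (f : Fin N → ℚ) → Σ N (λ u → δ u i * f u) ≡ f i
Σ-δ (suc N) Fin.zero f = begin
  1ℚ * f Fin.zero + Σ N (λ u → 0ℚ * f (Fin.suc u))
    ≡⟨ cong (λ s → 1ℚ * f Fin.zero + s) (Σ-zeroˡ N (λ u → f (Fin.suc u))) ⟩
  1ℚ * f Fin.zero + 0ℚ
    ≡⟨ 1*x+0≡x (f Fin.zero) ⟩
  f Fin.zero ∎
  where
  1*x+0≡x : ∀ x → 1ℚ * x + 0ℚ ≡ x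
  1*x+0≡x = solve-∀ ℚ-ring
Σ-δ (suc N) (Fin.suc i) f = begin
  0ℚ * f Fin.zero + Σ N (λ u → δ u i * f (Fin.suc u))
    ≡⟨ cong (λ s → 0ℚ * f Fin.zero + s) (Σ-δ N i _) ⟩
  0ℚ * f Fin.zero + f (Fin.suc i)
    ≡⟨ 0*x+y≡y (f Fin.zero) _ ⟩
  f (Fin.suc i) ∎
  where
  0*x+y≡y : ∀ x y → 0ℚ * x + y ≡ y
  0*x+y≡y = solve-∀ ℚ-ring

Σℕ : ℕ → (ℕ → ℚ) → ℚ
Σℕ n f = Σ n (λ k → f (toℕ k))

Σℕ-cong : ∀ n {f g : ℕ → ℚ} → (∀ t → t < n → f t ≡ g t) → Σℕ n f ≡ Σℕ n g
Σℕ-cong n f≗g = Σ-cong n (λ k → f≗g (toℕ k) (FinP.toℕ<n k))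

Σℕ-split : ∀ m n (f : ℕ → ℚ) → Σℕ (m ℕ.+ n) f ≡ Σℕ m f + Σℕ n (λ t → f (m ℕ.+ t))
Σℕ-split zero    n f = sym (ℚP.+-identityˡ (Σℕ n f))
Σℕ-split (suc m) n f = begin
  f 0 + Σℕ (m ℕ.+ n) (λ t → f (suc t))
    ≡⟨ cong (λ s → f 0 + s) (Σℕ-split m n (λ t → f (suc t))) ⟩
  f 0 + (Σℕ m (λ t → f (suc t)) + Σℕ n (λ t → f (suc m ℕ.+ t)))
    ≡⟨ ℚP.+-assoc (f 0) _ _ ⟨
  f 0 + Σℕ m (λ t → f (suc t)) + Σℕ n (λ t → f (suc m ℕ.+ t)) ∎

Σℕ-distrib-+ : ∀ n (f g : ℕ → ℚ) → Σℕ n (λ t → f t + g t) ≡ Σℕ n f + Σℕ n g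
Σℕ-distrib-+ n f g = Σ-distrib-+ n (λ k → f (toℕ k)) (λ k → g (toℕ k))

Σℕ-distrib-- : ∀ n (f g : ℕ → ℚ) → Σℕ n (λ t → f t - g t) ≡ Σℕ n f - Σℕ n g
Σℕ-distrib-- n f g = Σ-distrib-- n (λ k → f (toℕ k)) (λ k → g (toℕ k))

*-distribˡ-Σℕ : ∀ n x (f : ℕ → ℚ) → x * Σℕ n f ≡ Σℕ n (λ t → x * f t)
*-distribˡ-Σℕ n x f = *-distribˡ-Σ n x (λ k → f (toℕ k))

*-distribʳ-Σℕ : ∀ n x (f : ℕ → ℚ) → Σℕ n f * x ≡ Σℕ n (λ t → f t * x)
*-distribʳ-Σℕ n x f = *-distribʳ-Σ n x (λ k → f (toℕ k))

Σℕ-zeroˡ : ∀ n (f : ℕ → ℚ) → Σℕ n (λ t → 0ℚ * f t) ≡ 0ℚ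
Σℕ-zeroˡ n f = Σ-zeroˡ n (λ k → f (toℕ k))

Σℕ-const : ∀ n x → Σℕ n (λ _ → x) ≡ n × 1ℚ * x
Σℕ-const n x = begin
  Σℕ n (λ _ → x)    ≡⟨ Σ≡sum n (λ _ → x) ⟩
  sum {n} (λ _ → x) ≡⟨ sum-replicate n ⟩
  n × x             ≡⟨ ×-congʳ n (ℚP.*-identityˡ x) ⟨
  n × (1ℚ * x)      ≡⟨ ×-assoc-* n 1ℚ x ⟨
  n × 1ℚ * x        ∎

Σℕ-δ : ∀ {n y} → y < n → (f : ℕ → ℚ) → Σℕ n (λ t → indicator (t ℕ.≡ᵇ y) * f t) ≡ f y
Σℕ-δ {n} {y} y<n f = begin
  Σ n (λ k → indicator (toℕ k ℕ.≡ᵇ y) * f (toℕ k))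
    ≡⟨ Σ-cong n (λ k → cong (λ i → indicator (toℕ k ℕ.≡ᵇ i) * f (toℕ k)) (FinP.toℕ-fromℕ< y<n)) ⟨
  Σ n (λ k → δ k (Fin.fromℕ< y<n) * f (toℕ k))
    ≡⟨ Σ-δ n (Fin.fromℕ< y<n) (λ k → f (toℕ k)) ⟩
  f (toℕ (Fin.fromℕ< y<n))
    ≡⟨ cong f (FinP.toℕ-fromℕ< y<n) ⟩
  f y ∎

Σℕ-δ-out : ∀ {n y} → n ≤ y → (f : ℕ → ℚ) → Σℕ n (λ t → indicator (t ℕ.≡ᵇ y) * f t) ≡ 0ℚ
Σℕ-δ-out {n} {y} n≤y f = begin
  Σℕ n (λ t → indicator (t ℕ.≡ᵇ y) * f t)
    ≡⟨ Σℕ-cong n (λ t t<n → cong (λ e → indicator e * f t) (≡ᵇ-false (ℕP.<⇒≢ (ℕP.<-≤-trans t<n n≤y)))) ⟩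
  Σℕ n (λ t → 0ℚ * f t)
    ≡⟨ Σ-zeroˡ n (λ k → f (toℕ k)) ⟩
  0ℚ ∎

Σℕ-delete : ∀ {n x} → x < n → (f : ℕ → ℚ) →
  Σℕ n (λ y → indicator (not (x ℕ.≡ᵇ y)) * f y) ≡ Σℕ n f - f x
Σℕ-delete {n} {x} x<n f = begin
  Σℕ n (λ y → indicator (not (x ℕ.≡ᵇ y)) * f y)
    ≡⟨ Σℕ-cong n (λ y _ → trans (indicator-not (x ℕ.≡ᵇ y) (f y)) (cong (λ e → f y - indicator e * f y) (≡ᵇ-sym x y))) ⟩
  Σℕ n (λ y → f y - indicator (y ℕ.≡ᵇ x) * f y)
    ≡⟨ Σ-distrib-- n _ _ ⟩
  Σℕ n f - Σℕ n (λ y → indicator (y ℕ.≡ᵇ x) * f y)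
    ≡⟨ cong (λ s → Σℕ n f - s) (Σℕ-δ x<n f) ⟩
  Σℕ n f - f x ∎

Σℕ-offDiagonal : ∀ {n y} → y < n → ∀ k → Σℕ n (λ x → k * (1ℚ - indicator (x ℕ.≡ᵇ y))) ≡ k * (n × 1ℚ - 1ℚ)
Σℕ-offDiagonal {n} {y} y<n k = begin
  Σℕ n (λ x → k * (1ℚ - indicator (x ℕ.≡ᵇ y)))
    ≡⟨ *-distribˡ-Σℕ n k (λ x → 1ℚ - indicator (x ℕ.≡ᵇ y)) ⟨
  k * Σℕ n (λ x → 1ℚ - indicator (x ℕ.≡ᵇ y))
    ≡⟨ cong (k *_) (Σℕ-distrib-- n (λ _ → 1ℚ) (λ x → indicator (x ℕ.≡ᵇ y))) ⟩
  k * (Σℕ n (λ _ → 1ℚ) - Σℕ n (λ x → indicator (x ℕ.≡ᵇ y)))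
    ≡⟨ cong₂ (λ p q → k * (p - q)) (trans (Σℕ-const n 1ℚ) (ℚP.*-identityʳ (n × 1ℚ))) indicators ⟩
  k * (n × 1ℚ - 1ℚ) ∎
  where
  indicators : Σℕ n (λ x → indicator (x ℕ.≡ᵇ y)) ≡ 1ℚ
  indicators = trans (Σℕ-cong n (λ x _ → sym (ℚP.*-identityʳ (indicator (x ℕ.≡ᵇ y))))) (Σℕ-δ y<n (λ _ → 1ℚ))

sumBelow sumSquaresBelow : ℚ → ℚ
sumBelow n = ½ * (n * (n - 1ℚ))
sumSquaresBelow n = inv (6 × 1ℚ) * ((n - 1ℚ) * n * (2 × 1ℚ * n - 1ℚ))

Σℕ-id : ∀ n → Σℕ n (λ t → t × 1ℚ) ≡ sumBelow (n × 1ℚ)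
Σℕ-id zero    = refl
Σℕ-id (suc n) = begin
  0ℚ + Σℕ n (λ t → 1ℚ + t × 1ℚ)
    ≡⟨ cong (λ q → 0ℚ + q) (Σℕ-distrib-+ n (λ _ → 1ℚ) (λ t → t × 1ℚ)) ⟩
  0ℚ + (Σℕ n (λ _ → 1ℚ) + Σℕ n (λ t → t × 1ℚ))
    ≡⟨ cong₂ (λ p q → 0ℚ + (p + q)) (Σℕ-const n 1ℚ) (Σℕ-id n) ⟩
  0ℚ + (n × 1ℚ * 1ℚ + sumBelow (n × 1ℚ))
    ≡⟨ identity (n × 1ℚ) ⟩
  sumBelow (1ℚ + n × 1ℚ) ∎
  where
  identity : ∀ n → let sumBelow = λ n → ½ * (n * (n - 1ℚ)) in 0ℚ + (n * 1ℚ + sumBelow n) ≡ sumBelow (1ℚ + n)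
  identity = solve-∀ ℚ-ring

Σℕ-affine : ∀ n p q → Σℕ n (λ t → p + q * t × 1ℚ) ≡ n × 1ℚ * p + q * sumBelow (n × 1ℚ)
Σℕ-affine n p q = begin
  Σℕ n (λ t → p + q * t × 1ℚ)
    ≡⟨ Σℕ-distrib-+ n (λ _ → p) (λ t → q * t × 1ℚ) ⟩
  Σℕ n (λ _ → p) + Σℕ n (λ t → q * t × 1ℚ)
    ≡⟨ cong₂ _+_ (Σℕ-const n p) (sym (*-distribˡ-Σℕ n q (λ t → t × 1ℚ))) ⟩
  n × 1ℚ * p + q * Σℕ n (λ t → t × 1ℚ)
    ≡⟨ cong (λ s → n × 1ℚ * p + q * s) (Σℕ-id n) ⟩
  n × 1ℚ * p + q * sumBelow (n × 1ℚ) ∎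

Σℕ-square : ∀ n → Σℕ n (λ t → t × 1ℚ * t × 1ℚ) ≡ sumSquaresBelow (n × 1ℚ)
Σℕ-square zero    = refl
Σℕ-square (suc n) = begin
  0ℚ * 0ℚ + Σℕ n (λ t → (1ℚ + t × 1ℚ) * (1ℚ + t × 1ℚ))
    ≡⟨ cong (λ q → 0ℚ * 0ℚ + q) (Σℕ-cong n (λ t _ → expand (t × 1ℚ))) ⟩
  0ℚ * 0ℚ + Σℕ n (λ t → 1ℚ + 2 × 1ℚ * t × 1ℚ + t × 1ℚ * t × 1ℚ)
    ≡⟨ cong (λ q → 0ℚ * 0ℚ + q) (Σℕ-distrib-+ n (λ t → 1ℚ + 2 × 1ℚ * t × 1ℚ) (λ t → t × 1ℚ * t × 1ℚ)) ⟩
  0ℚ * 0ℚ + (Σℕ n (λ t → 1ℚ + 2 × 1ℚ * t × 1ℚ) + Σℕ n (λ t → t × 1ℚ * t × 1ℚ))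
    ≡⟨ cong₂ (λ p q → 0ℚ * 0ℚ + (p + q)) (Σℕ-affine n 1ℚ (2 × 1ℚ)) (Σℕ-square n) ⟩
  0ℚ * 0ℚ + (n × 1ℚ * 1ℚ + 2 × 1ℚ * sumBelow (n × 1ℚ) + sumSquaresBelow (n × 1ℚ))
    ≡⟨ identity (n × 1ℚ) ⟩
  sumSquaresBelow (1ℚ + n × 1ℚ) ∎
  where
  expand : ∀ t → (1ℚ + t) * (1ℚ + t) ≡ 1ℚ + 2 × 1ℚ * t + t * t
  expand = solve-∀ ℚ-ring
  identity : ∀ n → let sumBelow = λ n → ½ * (n * (n - 1ℚ))
                       sumSquaresBelow = λ n → inv (6 × 1ℚ) * ((n - 1ℚ) * n * (2 × 1ℚ * n - 1ℚ))
                   in 0ℚ * 0ℚ + (n * 1ℚ + 2 × 1ℚ * sumBelow n + sumSquaresBelow n) ≡ sumSquaresBelow (1ℚ + n)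
  identity = solve-∀ ℚ-ring

Σℕ-quadratic : ∀ n p q r → Σℕ n (λ t → p + q * t × 1ℚ + r * (t × 1ℚ * t × 1ℚ))
  ≡ n × 1ℚ * p + q * sumBelow (n × 1ℚ) + r * sumSquaresBelow (n × 1ℚ)
Σℕ-quadratic n p q r = begin
  Σℕ n (λ t → p + q * t × 1ℚ + r * (t × 1ℚ * t × 1ℚ))
    ≡⟨ Σℕ-distrib-+ n (λ t → p + q * t × 1ℚ) (λ t → r * (t × 1ℚ * t × 1ℚ)) ⟩
  Σℕ n (λ t → p + q * t × 1ℚ) + Σℕ n (λ t → r * (t × 1ℚ * t × 1ℚ))
    ≡⟨ cong₂ _+_ (Σℕ-affine n p q)
                 (trans (sym (*-distribˡ-Σℕ n r (λ t → t × 1ℚ * t × 1ℚ))) (cong (r *_) (Σℕ-square n))) ⟩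
  n × 1ℚ * p + q * sumBelow (n × 1ℚ) + r * sumSquaresBelow (n × 1ℚ) ∎

Σℕ-distance : ∀ {s e} → s ≤ e →
  Σℕ (suc e) (λ t → ℕ.∣ t - s ∣ × 1ℚ)
    ≡ ½ * (s × 1ℚ * (s × 1ℚ + 1ℚ) + (e × 1ℚ - s × 1ℚ) * (e × 1ℚ - s × 1ℚ + 1ℚ))
Σℕ-distance {s} {e} s≤e = begin
  Σℕ (suc e) (λ t → ℕ.∣ t - s ∣ × 1ℚ)
    ≡⟨ cong (λ n → Σℕ n (λ t → ℕ.∣ t - s ∣ × 1ℚ)) 1+e≡s+[1+r] ⟩
  Σℕ (s ℕ.+ suc r) (λ t → ℕ.∣ t - s ∣ × 1ℚ)
    ≡⟨ Σℕ-split s (suc r) (λ t → ℕ.∣ t - s ∣ × 1ℚ) ⟩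
  Σℕ s (λ t → ℕ.∣ t - s ∣ × 1ℚ) + Σℕ (suc r) (λ t → ℕ.∣ s ℕ.+ t - s ∣ × 1ℚ)
    ≡⟨ cong₂ _+_ (Σℕ-cong s (λ t t<s → before t<s)) (Σℕ-cong (suc r) (λ t _ → after t)) ⟩
  Σℕ s (λ t → s × 1ℚ - t × 1ℚ) + Σℕ (suc r) (λ t → t × 1ℚ)
    ≡⟨ cong₂ _+_ (trans (Σℕ-distrib-- s (λ _ → s × 1ℚ) (λ t → t × 1ℚ))
                        (cong₂ _-_ (Σℕ-const s (s × 1ℚ)) (Σℕ-id s)))
                 (Σℕ-id (suc r)) ⟩
  s × 1ℚ * s × 1ℚ - sumBelow (s × 1ℚ) + sumBelow (1ℚ + r × 1ℚ)
    ≡⟨ cong (λ R → s × 1ℚ * s × 1ℚ - sumBelow (s × 1ℚ) + sumBelow (1ℚ + R)) (∸×1 s≤e) ⟩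
  s × 1ℚ * s × 1ℚ - sumBelow (s × 1ℚ) + sumBelow (1ℚ + (e × 1ℚ - s × 1ℚ))
    ≡⟨ identity (s × 1ℚ) (e × 1ℚ) ⟩
  ½ * (s × 1ℚ * (s × 1ℚ + 1ℚ) + (e × 1ℚ - s × 1ℚ) * (e × 1ℚ - s × 1ℚ + 1ℚ)) ∎
  where
  r : ℕ
  r = e ∸ s
  1+e≡s+[1+r] : suc e ≡ s ℕ.+ suc r
  1+e≡s+[1+r] = trans (cong suc (sym (ℕP.m+[n∸m]≡n s≤e))) (sym (ℕP.+-suc s r))
  before : ∀ {t} → t < s → ℕ.∣ t - s ∣ × 1ℚ ≡ s × 1ℚ - t × 1ℚ
  before t<s = trans (cong (_× 1ℚ) (ℕP.m≤n⇒∣m-n∣≡n∸m (ℕP.<⇒≤ t<s))) (∸×1 (ℕP.<⇒≤ t<s))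
  after : ∀ t → ℕ.∣ s ℕ.+ t - s ∣ × 1ℚ ≡ t × 1ℚ
  after t = cong (_× 1ℚ) (trans (ℕP.∣-∣-comm (s ℕ.+ t) s) (ℕP.∣m-m+n∣≡n s t))
  identity : ∀ S E → let sumBelow = λ n → ½ * (n * (n - 1ℚ)) in
    S * S - sumBelow S + sumBelow (1ℚ + (E - S)) ≡ ½ * (S * (S + 1ℚ) + (E - S) * (E - S + 1ℚ))
  identity = solve-∀ ℚ-ring

-- Kemeny's constant from a scaled resistance

module Laplacian {N : ℕ} (G : Graph N) where

  A : Fin N → Fin N → ℚ
  A u w = indicator (adj G u w)

  laplacian : (Fin N → ℚ) → Fin N → ℚ
  laplacian h u = deg G u * h u - Σ N (λ w → A u w * h w)

  laplacian-const : ∀ z u → laplacian (λ _ → z) u ≡ 0ℚ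
  laplacian-const z u = begin
    deg G u * z - Σ N (λ w → A u w * z)   ≡⟨ cong (λ s → deg G u * z - s) (*-distribʳ-Σ N z (A u)) ⟨
    deg G u * z - deg G u * z             ≡⟨ x-x≡0 (deg G u * z) ⟩
    0ℚ                                    ∎
    where
    x-x≡0 : ∀ x → x - x ≡ 0ℚ
    x-x≡0 = solve-∀ ℚ-ring

  laplacian-shift : ∀ (f g : Fin N → ℚ) z u →
    laplacian (λ w → f w - g w + z) u ≡ laplacian f u - laplacian g u
  laplacian-shift f g z u = begin
    deg G u * (f u - g u + z) - Σ N (λ w → A u w * (f w - g w + z))
      ≡⟨ cong (λ s → deg G u * (f u - g u + z) - s) neighbours ⟩
    deg G u * (f u - g u + z)
      - (Σ N (λ w → A u w * f w) - Σ N (λ w → A u w * g w) + Σ N (λ w → A u w * z))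
      ≡⟨ regroup (deg G u) (f u) (g u) z _ _ _ ⟩
    laplacian f u - laplacian g u + laplacian (λ _ → z) u
      ≡⟨ cong (λ s → laplacian f u - laplacian g u + s) (laplacian-const z u) ⟩
    laplacian f u - laplacian g u + 0ℚ
      ≡⟨ ℚP.+-identityʳ _ ⟩
    laplacian f u - laplacian g u ∎
    where
    distrib : ∀ a x y z → a * (x - y + z) ≡ a * x - a * y + a * z
    distrib = solve-∀ ℚ-ring
    neighbours : Σ N (λ w → A u w * (f w - g w + z))
               ≡ Σ N (λ w → A u w * f w) - Σ N (λ w → A u w * g w) + Σ N (λ w → A u w * z)
    neighbours = begin
      Σ N (λ w → A u w * (f w - g w + z))
        ≡⟨ Σ-cong N (λ w → distrib (A u w) (f w) (g w) z) ⟩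
      Σ N (λ w → A u w * f w - A u w * g w + A u w * z)
        ≡⟨ Σ-distrib-+ N _ _ ⟩
      Σ N (λ w → A u w * f w - A u w * g w) + Σ N (λ w → A u w * z)
        ≡⟨ cong (λ s → s + Σ N (λ w → A u w * z)) (Σ-distrib-- N _ _) ⟩
      Σ N (λ w → A u w * f w) - Σ N (λ w → A u w * g w) + Σ N (λ w → A u w * z) ∎
    regroup : ∀ d x y z p q r → d * (x - y + z) - (p - q + r) ≡ (d * x - p) - (d * y - q) + (d * z - r)
    regroup = solve-∀ ℚ-ring

  laplacian-selfAdjoint : (∀ u w → adj G u w ≡ adj G w u) → ∀ (g f : Fin N → ℚ) →
    Σ N (λ u → laplacian g u * f u) ≡ Σ N (λ u → g u * laplacian f u)
  laplacian-selfAdjoint adj-sym g f = begin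
    Σ N (λ u → laplacian g u * f u)
      ≡⟨ Σ-cong N (λ u → expand (deg G u) (g u) _ (f u)) ⟩
    Σ N (λ u → g u * (deg G u * f u) - Σ N (λ w → A u w * g w) * f u)
      ≡⟨ Σ-distrib-- N _ _ ⟩
    Σ N (λ u → g u * (deg G u * f u)) - Σ N (λ u → Σ N (λ w → A u w * g w) * f u)
      ≡⟨ cong (λ s → Σ N (λ u → g u * (deg G u * f u)) - s) adjacency-term ⟩
    Σ N (λ u → g u * (deg G u * f u)) - Σ N (λ u → g u * Σ N (λ w → A u w * f w))
      ≡⟨ Σ-distrib-- N _ _ ⟨
    Σ N (λ u → g u * (deg G u * f u) - g u * Σ N (λ w → A u w * f w))
      ≡⟨ Σ-cong N (λ u → factor (g u) _ _) ⟩
    Σ N (λ u → g u * laplacian f u) ∎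
    where
    expand : ∀ d g s f → (d * g - s) * f ≡ g * (d * f) - s * f
    expand = solve-∀ ℚ-ring
    factor : ∀ g x y → g * x - g * y ≡ g * (x - y)
    factor = solve-∀ ℚ-ring
    swap : ∀ a g f → a * g * f ≡ g * (a * f)
    swap = solve-∀ ℚ-ring
    adjacency-term : Σ N (λ u → Σ N (λ w → A u w * g w) * f u)
                   ≡ Σ N (λ u → g u * Σ N (λ w → A u w * f w))
    adjacency-term = begin
      Σ N (λ u → Σ N (λ w → A u w * g w) * f u)  ≡⟨ Σ-cong N (λ u → *-distribʳ-Σ N (f u) _) ⟩
      Σ N (λ u → Σ N (λ w → A u w * g w * f u))  ≡⟨ Σ-comm N N _ ⟩
      Σ N (λ w → Σ N (λ u → A u w * g w * f u))
        ≡⟨ Σ-cong N (λ w → Σ-cong N (λ u →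
             trans (cong (λ e → indicator e * g w * f u) (adj-sym u w)) (swap (A w u) (g w) (f u)))) ⟩
      Σ N (λ w → Σ N (λ u → g w * (A w u * f u)))  ≡⟨ Σ-cong N (λ w → *-distribˡ-Σ N (g w) _) ⟨
      Σ N (λ w → g w * Σ N (λ u → A w u * f u))    ∎

  laplacian-hittingTimes : ∀ {m} → IsHittingTimes G m → ∀ {u j} → u ≢ j →
    laplacian (λ w → m w j) u ≡ deg G u
  laplacian-hittingTimes {m} (_ , harmonic) {u} {j} u≢j = begin
    deg G u * m u j - Σ N (λ w → A u w * m w j)
      ≡⟨ cong (λ s → s - Σ N (λ w → A u w * m w j)) (harmonic u j u≢j) ⟩
    deg G u + Σ N (λ w → A u w * m w j) - Σ N (λ w → A u w * m w j)
      ≡⟨ x+y-y≡x (deg G u) _ ⟩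
    deg G u ∎
    where
    x+y-y≡x : ∀ x y → x + y - y ≡ x
    x+y-y≡x = solve-∀ ℚ-ring

-- These conditions characterise scale/2 times the effective resistance of G.
record ScaledResistance {N : ℕ} (G : Graph N) : Set where
  field
    ρ           : Fin N → Fin N → ℚ
    β           : Fin N → ℚ
    scale       : ℚ
    scale≢0     : scale ≢ 0ℚ
    ρ-sym       : ∀ u v → ρ u v ≡ ρ v u
    ρ-diag      : ∀ u → ρ u u ≡ 0ℚ
    laplacian-ρ : ∀ u v → Laplacian.laplacian G (λ w → ρ w v) u ≡ β u - scale * δ u v

module _ {N : ℕ} {G : Graph N} (adj-sym : ∀ u w → adj G u w ≡ adj G w u)
         (R : ScaledResistance G) where

  open Laplacian G
  open ScaledResistance R

  potential : Fin N → ℚ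
  potential v = Σ N (λ u → ρ u v * deg G u)

  scale*hittingTime : ∀ {m} → IsHittingTimes G m → ∀ i j →
    scale * m i j ≡ potential j - potential i + ρ i j * twiceEdges G
  scale*hittingTime {m} hit@(m-diag , _) i j = begin
    scale * m i j
      ≡⟨ x≡x-y*0 (scale * m i j) scale ⟩
    scale * m i j - scale * 0ℚ
      ≡⟨ cong₂ (λ p q → scale * p - scale * q) (Σ-δ N i (λ u → m u j)) (trans (Σ-δ N j (λ u → m u j)) (m-diag j)) ⟨
    scale * Σ N (λ u → δ u i * m u j) - scale * Σ N (λ u → δ u j * m u j)
      ≡⟨ cong₂ _-_ (*-distribˡ-Σ N scale _) (*-distribˡ-Σ N scale _) ⟩
    Σ N (λ u → scale * (δ u i * m u j)) - Σ N (λ u → scale * (δ u j * m u j))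
      ≡⟨ Σ-distrib-- N _ _ ⟨
    Σ N (λ u → scale * (δ u i * m u j) - scale * (δ u j * m u j))
      ≡⟨ Σ-cong N (λ u → trans (factor scale (δ u i) (δ u j) (m u j)) (cong (_* m u j) (sym (laplacian-g u)))) ⟩
    Σ N (λ u → laplacian g u * m u j)
      ≡⟨ laplacian-selfAdjoint adj-sym g (λ w → m w j) ⟩
    Σ N (λ u → g u * laplacian (λ w → m w j) u)
      ≡⟨ Σ-cong N g*laplacian-m ⟩
    Σ N (λ u → (ρ u j - ρ u i + ρ i j) * deg G u)
      ≡⟨ Σ-cong N (λ u → distrib (ρ u j) (ρ u i) (ρ i j) (deg G u)) ⟩
    Σ N (λ u → ρ u j * deg G u - ρ u i * deg G u + ρ i j * deg G u)
      ≡⟨ trans (Σ-distrib-+ N _ _) (cong₂ _+_ (Σ-distrib-- N _ _) (sym (*-distribˡ-Σ N (ρ i j) (deg G)))) ⟩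
    potential j - potential i + ρ i j * twiceEdges G ∎
    where
    g : Fin N → ℚ
    g u = ρ u j - ρ u i + ρ i j

    laplacian-g : ∀ u → laplacian g u ≡ scale * δ u i - scale * δ u j
    laplacian-g u = begin
      laplacian g u                                        ≡⟨ laplacian-shift (λ w → ρ w j) (λ w → ρ w i) (ρ i j) u ⟩
      laplacian (λ w → ρ w j) u - laplacian (λ w → ρ w i) u  ≡⟨ cong₂ _-_ (laplacian-ρ u j) (laplacian-ρ u i) ⟩
      (β u - scale * δ u j) - (β u - scale * δ u i)       ≡⟨ cancel (β u) (scale * δ u j) (scale * δ u i) ⟩
      scale * δ u i - scale * δ u j                        ∎
      where
      cancel : ∀ b x y → (b - x) - (b - y) ≡ y - x
      cancel = solve-∀ ℚ-ring

    g-vanishes : g j ≡ 0ℚ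
    g-vanishes = begin
      ρ j j - ρ j i + ρ i j  ≡⟨ cong₂ (λ p q → p - ρ j i + q) (ρ-diag j) (ρ-sym i j) ⟩
      0ℚ - ρ j i + ρ j i     ≡⟨ 0-x+x≡0 (ρ j i) ⟩
      0ℚ                     ∎
      where
      0-x+x≡0 : ∀ x → 0ℚ - x + x ≡ 0ℚ
      0-x+x≡0 = solve-∀ ℚ-ring

    g*laplacian-m : ∀ u → g u * laplacian (λ w → m w j) u ≡ g u * deg G u
    g*laplacian-m u with u Fin.≟ j
    ... | no u≢j = cong (g u *_) (laplacian-hittingTimes hit u≢j)
    ... | yes refl = begin
      g u * laplacian (λ w → m w u) u  ≡⟨ cong (_* laplacian (λ w → m w u) u) g-vanishes ⟩
      0ℚ * laplacian (λ w → m w u) u   ≡⟨ ℚP.*-zeroˡ (laplacian (λ w → m w u) u) ⟩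
      0ℚ                               ≡⟨ ℚP.*-zeroˡ (deg G u) ⟨
      0ℚ * deg G u                     ≡⟨ cong (_* deg G u) g-vanishes ⟨
      g u * deg G u                    ∎

    x≡x-y*0 : ∀ x y → x ≡ x - y * 0ℚ
    x≡x-y*0 = solve-∀ ℚ-ring
    factor : ∀ c a b x → c * (a * x) - c * (b * x) ≡ (c * a - c * b) * x
    factor = solve-∀ ℚ-ring
    distrib : ∀ x y z d → (x - y + z) * d ≡ x * d - y * d + z * d
    distrib = solve-∀ ℚ-ring

  kemenyFrom-scaledResistance : ∀ {m} → IsHittingTimes G m → ∀ i →
    kemenyFrom G m i ≡ inv (twiceEdges G) * (inv scale * Σ N (λ j → deg G j * potential j))
  kemenyFrom-scaledResistance {m} hit i = begin
    Σ N (λ j → deg G j * inv T * m i j)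
      ≡⟨ Σ-cong N (λ j → cong (deg G j * inv T *_) (hittingTime j)) ⟩
    Σ N (λ j → deg G j * inv T * (inv scale * (potential j - potential i + ρ i j * T)))
      ≡⟨ Σ-cong N (λ j → regroup (deg G j) (inv T) (inv scale) (potential j) (potential i) (ρ i j) T) ⟩
    Σ N (λ j → inv T * inv scale * (deg G j * potential j - deg G j * potential i + ρ i j * deg G j * T))
      ≡⟨ *-distribˡ-Σ N (inv T * inv scale) _ ⟨
    inv T * inv scale * Σ N (λ j → deg G j * potential j - deg G j * potential i + ρ i j * deg G j * T)
      ≡⟨ cong (inv T * inv scale *_) (trans (Σ-distrib-+ N _ _) (cong₂ _+_ (Σ-distrib-- N _ _) (sym (*-distribʳ-Σ N T _)))) ⟩
    inv T * inv scale * (S - Σ N (λ j → deg G j * potential i) + Σ N (λ j → ρ i j * deg G j) * T)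
      ≡⟨ cong₂ (λ p q → inv T * inv scale * (S - p + q * T))
           (sym (*-distribʳ-Σ N (potential i) (deg G)))
           (Σ-cong N (λ j → cong (_* deg G j) (ρ-sym i j))) ⟩
    inv T * inv scale * (S - T * potential i + potential i * T)
      ≡⟨ cancel (inv T) (inv scale) S T (potential i) ⟩
    inv T * (inv scale * S) ∎
    where
    T = twiceEdges G
    S = Σ N (λ j → deg G j * potential j)

    hittingTime : ∀ j → m i j ≡ inv scale * (potential j - potential i + ρ i j * T)
    hittingTime j = begin
      m i j                        ≡⟨ x≡y*[z*x] (m i j) (inv scale) scale (inv-inverseˡ scale≢0) ⟩
      inv scale * (scale * m i j)  ≡⟨ cong (inv scale *_) (scale*hittingTime hit i j) ⟩
      inv scale * (potential j - potential i + ρ i j * T) ∎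
      where
      x≡y*[z*x] : ∀ x y z → y * z ≡ 1ℚ → x ≡ y * (z * x)
      x≡y*[z*x] x y z yz≡1 = begin
        x            ≡⟨ ℚP.*-identityˡ x ⟨
        1ℚ * x       ≡⟨ cong (_* x) yz≡1 ⟨
        y * z * x    ≡⟨ ℚP.*-assoc y z x ⟩
        y * (z * x)  ∎

    regroup : ∀ d t c p q r T → d * t * (c * (p - q + r * T)) ≡ t * c * (d * p - d * q + r * d * T)
    regroup = solve-∀ ℚ-ring
    cancel : ∀ t c s T p → t * c * (s - T * p + p * T) ≡ t * (c * s)
    cancel = solve-∀ ℚ-ring

-- The barbell graph B(1,a,b,c)

barbellTwiceEdges : ℚ → ℚ → ℚ → ℚ
barbellTwiceEdges B C E = B * B + C * C + B + C + 2 × 1ℚ * E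

barbellScale : ℚ → ℚ → ℚ
barbellScale B C = 2 × 1ℚ * ((1ℚ + B) * (1ℚ + C))

-- κ Σ_{u,v} d_u d_v r(u,v) with κ = (b+1)(c+1), grouped by the blocks (K_b, path, K_c)
-- containing u and v; B, C and E stand for b, c and a − 1.
barbellResistanceSum : ℚ → ℚ → ℚ → ℚ
barbellResistanceSum B C E = LL + RR + 2 × 1ℚ * (LP + RP + LR) + PP
  where
  B₁ C₁ κ Dp LL RR LP RP LR PP : ℚ
  B₁ = 1ℚ + B
  C₁ = 1ℚ + C
  κ  = B₁ * C₁
  Dp = B + C + 2 × 1ℚ * E
  LL = 2 × 1ℚ * C₁ * (B * B * B) * (B - 1ℚ)
  RR = 2 × 1ℚ * B₁ * (C * C * C) * (C - 1ℚ)
  LP = B * B * (2 × 1ℚ * C₁ * Dp + κ * (C₁ * E + E * (E - 1ℚ)))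
  RP = C * C * (2 × 1ℚ * B₁ * Dp + κ * (B₁ * E + E * (E - 1ℚ)))
  LR = B * B * (C * C) * (2 × 1ℚ * C₁ + 2 × 1ℚ * B₁ + κ * E)
  PP = κ * (4 × 1ℚ * inv (3 × 1ℚ) * (E * (E + 1ℚ) * (E + 2 × 1ℚ)) + 2 × 1ℚ * (E * (E + 1ℚ)) * (B + C - 2 × 1ℚ)
            + 2 × 1ℚ * ((B - 1ℚ) * (C - 1ℚ)) * E)

barbellKemeny : ℚ → ℚ → ℚ → ℚ
barbellKemeny B C E = inv (barbellTwiceEdges B C E) * (inv (barbellScale B C) * barbellResistanceSum B C E)

barbellScale≢0 : ∀ b c → barbellScale (b × 1ℚ) (c × 1ℚ) ≢ 0ℚ
barbellScale≢0 b c = subst (_≢ 0ℚ) 2*[1+b]*[1+c]≡ (×1-≢0 (2 ℕ.* (suc b ℕ.* suc c)))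
  where
  2*[1+b]*[1+c]≡ : (2 ℕ.* (suc b ℕ.* suc c)) × 1ℚ ≡ barbellScale (b × 1ℚ) (c × 1ℚ)
  2*[1+b]*[1+c]≡ = trans (×1-homo-* 2 (suc b ℕ.* suc c)) (cong (2 × 1ℚ *_) (×1-homo-* (suc b) (suc c)))

module BarbellGraph (a b c : ℕ) (0<a : 0 < a) where

  adjℕ : ℕ → ℕ → Bool
  adjℕ = barbellAdjℕ a b c

  b≤b+ : ∀ t → b ≤ b ℕ.+ t
  b≤b+ = ℕP.m≤m+n b

  b+a≤b+a+ : ∀ u → b ℕ.+ a ≤ b ℕ.+ a ℕ.+ u
  b+a≤b+a+ = ℕP.m≤m+n (b ℕ.+ a)

  b<b+a+ : ∀ u → b < b ℕ.+ a ℕ.+ u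
  b<b+a+ u = ℕP.<-≤-trans (ℕP.m<m+n b 0<a) (b+a≤b+a+ u)

  module _ {x} (x<b : x < b) where
    left-<b : (x ℕ.<ᵇ b) ≡ true
    left-<b = <ᵇ-true x<b
    left-∉path : (b ℕ.<ᵇ suc x) ≡ false
    left-∉path = <ᵇ-false x<b
    left-∉right : (b ℕ.+ a ℕ.<ᵇ suc x) ≡ false
    left-∉right = <ᵇ-false (ℕP.≤-trans x<b (b≤b+ a))
    left-≢first : (x ℕ.≡ᵇ b) ≡ false
    left-≢first = ≡ᵇ-false (ℕP.<⇒≢ x<b)
    left-≢last : (suc x ℕ.≡ᵇ b ℕ.+ a) ≡ false
    left-≢last = ≡ᵇ-false (ℕP.<⇒≢ (ℕP.≤-<-trans x<b (ℕP.m<m+n b 0<a)))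
    left-≢path : ∀ t → (x ℕ.≡ᵇ b ℕ.+ t) ≡ false
    left-≢path t = ≡ᵇ-false (ℕP.<⇒≢ (ℕP.<-≤-trans x<b (b≤b+ t)))
    left-≢right : ∀ u → (x ℕ.≡ᵇ b ℕ.+ a ℕ.+ u) ≡ false
    left-≢right u = ≡ᵇ-false (ℕP.<⇒≢ (ℕP.<-trans x<b (b<b+a+ u)))

  module _ {t} (t<a : t < a) where
    path-≮b : (b ℕ.+ t ℕ.<ᵇ b) ≡ false
    path-≮b = <ᵇ-false (b≤b+ t)
    path-≥b : (b ℕ.<ᵇ suc (b ℕ.+ t)) ≡ true
    path-≥b = <ᵇ-true (s≤s (b≤b+ t))
    path-<b+a : (b ℕ.+ t ℕ.<ᵇ b ℕ.+ a) ≡ true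
    path-<b+a = <ᵇ-true (ℕP.+-monoʳ-< b t<a)
    path-∉right : (b ℕ.+ a ℕ.<ᵇ suc (b ℕ.+ t)) ≡ false
    path-∉right = <ᵇ-false (ℕP.+-monoʳ-< b t<a)
    path-≢right : ∀ u → (b ℕ.+ t ℕ.≡ᵇ b ℕ.+ a ℕ.+ u) ≡ false
    path-≢right u = ≡ᵇ-false (ℕP.<⇒≢ (ℕP.<-≤-trans (ℕP.+-monoʳ-< b t<a) (b+a≤b+a+ u)))

  module _ {u} (u<c : u < c) where
    right-≮b : (b ℕ.+ a ℕ.+ u ℕ.<ᵇ b) ≡ false
    right-≮b = <ᵇ-false (ℕP.<⇒≤ (b<b+a+ u))
    right-≥b : (b ℕ.<ᵇ suc (b ℕ.+ a ℕ.+ u)) ≡ true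
    right-≥b = <ᵇ-true (s≤s (ℕP.<⇒≤ (b<b+a+ u)))
    right-≮b+a : (b ℕ.+ a ℕ.+ u ℕ.<ᵇ b ℕ.+ a) ≡ false
    right-≮b+a = <ᵇ-false (b+a≤b+a+ u)
    right-≥b+a : (b ℕ.+ a ℕ.<ᵇ suc (b ℕ.+ a ℕ.+ u)) ≡ true
    right-≥b+a = <ᵇ-true (s≤s (b+a≤b+a+ u))
    right-<N : (b ℕ.+ a ℕ.+ u ℕ.<ᵇ b ℕ.+ a ℕ.+ c) ≡ true
    right-<N = <ᵇ-true (ℕP.+-monoʳ-< (b ℕ.+ a) u<c)
    right-≢first : (b ℕ.+ a ℕ.+ u ℕ.≡ᵇ b) ≡ false
    right-≢first = ≡ᵇ-false (ℕP.>⇒≢ (b<b+a+ u))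
    right-≢last : (suc (b ℕ.+ a ℕ.+ u) ℕ.≡ᵇ b ℕ.+ a) ≡ false
    right-≢last = ≡ᵇ-false (ℕP.>⇒≢ (s≤s (b+a≤b+a+ u)))

  adj-L-L : ∀ {x y} → x < b → y < b → adjℕ x y ≡ not (x ℕ.≡ᵇ y)
  adj-L-L {x} {y} x<b y<b
    rewrite left-<b x<b | left-<b y<b | left-≢first x<b | left-≢first y<b
          | left-∉path x<b | left-∉right x<b | left-∉right y<b
    with x ℕ.≡ᵇ y
  ... | true  = refl
  ... | false = refl

  adj-L-P : ∀ {x t} → x < b → t < a → adjℕ x (b ℕ.+ t) ≡ (t ℕ.≡ᵇ 0)
  adj-L-P {x} {t} x<b t<a
    rewrite left-≢path x<b t | left-∉path x<b | left-<b x<b | path-≮b t<a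
          | +-≡ᵇ-id b {t} | left-∉right x<b | path-∉right t<a
    = BoolP.∨-identityʳ _

  adj-L-R : ∀ {x u} → x < b → u < c → adjℕ x (b ℕ.+ a ℕ.+ u) ≡ false
  adj-L-R {x} {u} x<b u<c
    rewrite left-≢right x<b u | left-∉path x<b | left-<b x<b | right-≮b u<c
          | right-≢first u<c | left-∉right x<b | right-≥b+a u<c | right-<N u<c | left-≢last x<b
    = refl

  adj-P-L : ∀ {t y} → t < a → y < b → adjℕ (b ℕ.+ t) y ≡ (t ℕ.≡ᵇ 0)
  adj-P-L {t} {y} t<a y<b
    rewrite ≡ᵇ-sym (b ℕ.+ t) y | left-≢path y<b t | left-∉path y<b | left-<b y<b | path-≮b t<a
          | path-≥b t<a | path-<b+a t<a | +-≡ᵇ-id b {t} | left-∉right y<b | path-∉right t<a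
    = BoolP.∨-identityʳ _

  adj-P-P : ∀ {t s} → t < a → s < a →
            adjℕ (b ℕ.+ t) (b ℕ.+ s) ≡ ((suc t ℕ.≡ᵇ s) ∨ (suc s ℕ.≡ᵇ t))
  adj-P-P {t} {s} t<a s<a
    rewrite path-≮b t<a | path-≮b s<a | path-≥b t<a | path-≥b s<a | path-<b+a t<a | path-<b+a s<a
          | path-∉right t<a | path-∉right s<a | suc+-≡ᵇ-+ b {t} {s} | suc+-≡ᵇ-+ b {s} {t}
          | BoolP.∧-zeroʳ (not (b ℕ.+ t ℕ.≡ᵇ b ℕ.+ s))
    = BoolP.∨-identityʳ _

  adj-P-R : ∀ {t u} → t < a → u < c → adjℕ (b ℕ.+ t) (b ℕ.+ a ℕ.+ u) ≡ (suc t ℕ.≡ᵇ a)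
  adj-P-R {t} {u} t<a u<c
    rewrite path-≢right t<a u | path-≮b t<a | right-≮b u<c | path-≥b t<a | path-<b+a t<a
          | right-≥b u<c | right-≮b+a u<c | path-∉right t<a | right-≥b+a u<c | right-<N u<c
          | suc+-≡ᵇ-+ b {t} {a}
    = refl

  adj-R-L : ∀ {u y} → u < c → y < b → adjℕ (b ℕ.+ a ℕ.+ u) y ≡ false
  adj-R-L {u} {y} u<c y<b
    rewrite ≡ᵇ-sym (b ℕ.+ a ℕ.+ u) y | left-≢right y<b u | right-≮b u<c | left-<b y<b
          | right-≢first u<c | right-≥b u<c | right-≮b+a u<c | right-≥b+a u<c | right-<N u<c
          | left-∉right y<b | left-≢last y<b
    = refl

  adj-R-P : ∀ {u s} → u < c → s < a → adjℕ (b ℕ.+ a ℕ.+ u) (b ℕ.+ s) ≡ (suc s ℕ.≡ᵇ a)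
  adj-R-P {u} {s} u<c s<a
    rewrite ≡ᵇ-sym (b ℕ.+ a ℕ.+ u) (b ℕ.+ s) | path-≢right s<a u | right-≮b u<c | path-≮b s<a
          | right-≥b u<c | right-≮b+a u<c | right-≥b+a u<c | right-<N u<c | path-∉right s<a
          | suc+-≡ᵇ-+ b {s} {a}
    = BoolP.∨-identityʳ _

  adj-R-R : ∀ {u v} → u < c → v < c → adjℕ (b ℕ.+ a ℕ.+ u) (b ℕ.+ a ℕ.+ v) ≡ not (u ℕ.≡ᵇ v)
  adj-R-R {u} {v} u<c v<c
    rewrite right-≮b u<c | right-≮b v<c | right-≥b u<c | right-≮b+a u<c
          | right-≥b+a u<c | right-<N u<c | right-≥b+a v<c | right-<N v<c
          | right-≢last u<c | right-≢last v<c | +-≡ᵇ-+ (b ℕ.+ a) {u} {v}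
    with u ℕ.≡ᵇ v
  ... | true  = refl
  ... | false = refl

  -- L x, P t and R u are the vertices labelled x, b + t and b + a + u.
  data Vertex : Set where
    L P R : ℕ → Vertex

  classify : ℕ → Vertex
  classify x = if x ℕ.<ᵇ b then L x else if x ℕ.<ᵇ b ℕ.+ a then P (x ∸ b) else R (x ∸ (b ℕ.+ a))

  classify-L : ∀ {x} → x < b → classify x ≡ L x
  classify-L x<b rewrite left-<b x<b = refl

  classify-P : ∀ {t} → t < a → classify (b ℕ.+ t) ≡ P t
  classify-P {t} t<a rewrite path-≮b t<a | path-<b+a t<a = cong P (ℕP.m+n∸m≡n b t)

  classify-R : ∀ {u} → u < c → classify (b ℕ.+ a ℕ.+ u) ≡ R u
  classify-R {u} u<c rewrite right-≮b u<c | right-≮b+a u<c = cong R (ℕP.m+n∸m≡n (b ℕ.+ a) u)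

  data VertexView : ℕ → Set where
    left  : ∀ {x} → x < b → VertexView x
    path  : ∀ {t} → t < a → VertexView (b ℕ.+ t)
    right : ∀ {u} → u < c → VertexView (b ℕ.+ a ℕ.+ u)

  vertexView : ∀ {x} → x < a ℕ.+ b ℕ.+ c → VertexView x
  vertexView {x} x<N with x ℕP.<? b | x ℕP.<? b ℕ.+ a
  ... | yes x<b | _         = left x<b
  ... | no x≮b  | yes x<b+a = subst VertexView (ℕP.m+[n∸m]≡n b≤x) (path (m≤n⇒n<m+o⇒n∸m<o b≤x x<b+a))
    where b≤x = ℕP.≮⇒≥ x≮b
  ... | no _    | no x≮b+a  = subst VertexView (ℕP.m+[n∸m]≡n b+a≤x) (right (m≤n⇒n<m+o⇒n∸m<o b+a≤x x<b+a+c))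
    where b+a≤x = ℕP.≮⇒≥ x≮b+a
          x<b+a+c = subst (x <_) (cong (ℕ._+ c) (ℕP.+-comm a b)) x<N

  adj-sym : ∀ {x y} → x < a ℕ.+ b ℕ.+ c → y < a ℕ.+ b ℕ.+ c → adjℕ x y ≡ adjℕ y x
  adj-sym x<N y<N with vertexView x<N | vertexView y<N
  ... | left  {x} x<b | left  {y} y<b = trans (adj-L-L x<b y<b) (trans (cong not (≡ᵇ-sym x y)) (sym (adj-L-L y<b x<b)))
  ... | left  x<b     | path  s<a     = trans (adj-L-P x<b s<a) (sym (adj-P-L s<a x<b))
  ... | left  x<b     | right v<c     = trans (adj-L-R x<b v<c) (sym (adj-R-L v<c x<b))
  ... | path  t<a     | left  y<b     = trans (adj-P-L t<a y<b) (sym (adj-L-P y<b t<a))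
  ... | path  {t} t<a | path  {s} s<a = trans (adj-P-P t<a s<a) (trans (BoolP.∨-comm (suc t ℕ.≡ᵇ s) _) (sym (adj-P-P s<a t<a)))
  ... | path  t<a     | right v<c     = trans (adj-P-R t<a v<c) (sym (adj-R-P v<c t<a))
  ... | right u<c     | left  y<b     = trans (adj-R-L u<c y<b) (sym (adj-L-R y<b u<c))
  ... | right u<c     | path  s<a     = trans (adj-R-P u<c s<a) (sym (adj-P-R s<a u<c))
  ... | right {u} u<c | right {v} v<c = trans (adj-R-R u<c v<c) (trans (cong not (≡ᵇ-sym u v)) (sym (adj-R-R v<c u<c)))

  ΣL ΣR : (Vertex → ℚ) → ℚ
  ΣL F = Σℕ b (λ x → F (L x))
  ΣR F = Σℕ c (λ u → F (R u))

  Σ-blocks : ∀ (h : ℕ → Vertex → ℚ) → Σℕ (a ℕ.+ b ℕ.+ c) (λ z → h z (classify z))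
           ≡ Σℕ b (λ x → h x (L x)) + Σℕ a (λ t → h (b ℕ.+ t) (P t)) + Σℕ c (λ u → h (b ℕ.+ a ℕ.+ u) (R u))
  Σ-blocks h = begin
    Σℕ (a ℕ.+ b ℕ.+ c) h∘classify
      ≡⟨ cong (λ n → Σℕ (n ℕ.+ c) h∘classify) (ℕP.+-comm a b) ⟩
    Σℕ (b ℕ.+ a ℕ.+ c) h∘classify
      ≡⟨ Σℕ-split (b ℕ.+ a) c h∘classify ⟩
    Σℕ (b ℕ.+ a) h∘classify + Σℕ c (λ u → h∘classify (b ℕ.+ a ℕ.+ u))
      ≡⟨ cong (λ s → s + Σℕ c (λ u → h∘classify (b ℕ.+ a ℕ.+ u))) (Σℕ-split b a h∘classify) ⟩
    Σℕ b h∘classify + Σℕ a (λ t → h∘classify (b ℕ.+ t)) + Σℕ c (λ u → h∘classify (b ℕ.+ a ℕ.+ u))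
      ≡⟨ cong₂ _+_ (cong₂ _+_ (Σℕ-cong b (λ x x<b → cong (h x) (classify-L x<b)))
                              (Σℕ-cong a (λ t t<a → cong (h (b ℕ.+ t)) (classify-P t<a))))
                   (Σℕ-cong c (λ u u<c → cong (h (b ℕ.+ a ℕ.+ u)) (classify-R u<c))) ⟩
    Σℕ b (λ x → h x (L x)) + Σℕ a (λ t → h (b ℕ.+ t) (P t)) + Σℕ c (λ u → h (b ℕ.+ a ℕ.+ u) (R u)) ∎
    where
    h∘classify : ℕ → ℚ
    h∘classify z = h z (classify z)

  neighbourSum : ℕ → (Vertex → ℚ) → ℚ
  neighbourSum x F = Σℕ (a ℕ.+ b ℕ.+ c) (λ z → indicator (adjℕ x z) * F (classify z))

  neighbourSum-blocks : ∀ x F → neighbourSum x F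
    ≡ Σℕ b (λ y → indicator (adjℕ x y) * F (L y))
      + Σℕ a (λ s → indicator (adjℕ x (b ℕ.+ s)) * F (P s))
      + Σℕ c (λ v → indicator (adjℕ x (b ℕ.+ a ℕ.+ v)) * F (R v))
  neighbourSum-blocks x F = Σ-blocks (λ z V → indicator (adjℕ x z) * F V)

module BarbellResistance (l b c : ℕ) where

  a N : ℕ
  a = suc (suc l)
  N = a ℕ.+ b ℕ.+ c

  open BarbellGraph a b c z<s

  neighbourSum-L : ∀ {x} → x < b → ∀ F → neighbourSum x F ≡ ΣL F - F (L x) + F (P 0)
  neighbourSum-L {x} x<b F = begin
    neighbourSum x F
      ≡⟨ neighbourSum-blocks x F ⟩
    Σℕ b (λ y → indicator (adjℕ x y) * F (L y))
      + Σℕ a (λ s → indicator (adjℕ x (b ℕ.+ s)) * F (P s))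
      + Σℕ c (λ v → indicator (adjℕ x (b ℕ.+ a ℕ.+ v)) * F (R v))
      ≡⟨ cong₂ _+_ (cong₂ _+_
           (trans (Σℕ-cong b (λ y y<b → cong (λ e → indicator e * F (L y)) (adj-L-L x<b y<b)))
                  (Σℕ-delete x<b (λ y → F (L y))))
           (trans (Σℕ-cong a (λ s s<a → cong (λ e → indicator e * F (P s)) (adj-L-P x<b s<a)))
                  (Σℕ-δ {a} z<s (λ s → F (P s)))))
           (trans (Σℕ-cong c (λ v v<c → cong (λ e → indicator e * F (R v)) (adj-L-R x<b v<c)))
                  (Σℕ-zeroˡ c (λ v → F (R v)))) ⟩
    ΣL F - F (L x) + F (P 0) + 0ℚ
      ≡⟨ ℚP.+-identityʳ _ ⟩
    ΣL F - F (L x) + F (P 0) ∎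

  neighbourSum-P : ∀ {t} → t < a → ∀ F → neighbourSum (b ℕ.+ t) F
    ≡ indicator (t ℕ.≡ᵇ 0) * ΣL F
      + (Σℕ a (λ s → indicator (s ℕ.≡ᵇ suc t) * F (P s)) + Σℕ a (λ s → indicator (suc s ℕ.≡ᵇ t) * F (P s)))
      + indicator (suc t ℕ.≡ᵇ a) * ΣR F
  neighbourSum-P {t} t<a F = begin
    neighbourSum (b ℕ.+ t) F
      ≡⟨ neighbourSum-blocks (b ℕ.+ t) F ⟩
    Σℕ b (λ y → indicator (adjℕ (b ℕ.+ t) y) * F (L y))
      + Σℕ a (λ s → indicator (adjℕ (b ℕ.+ t) (b ℕ.+ s)) * F (P s))
      + Σℕ c (λ v → indicator (adjℕ (b ℕ.+ t) (b ℕ.+ a ℕ.+ v)) * F (R v))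
      ≡⟨ cong₂ _+_ (cong₂ _+_
           (trans (Σℕ-cong b (λ y y<b → cong (λ e → indicator e * F (L y)) (adj-P-L t<a y<b)))
                  (sym (*-distribˡ-Σℕ b (indicator (t ℕ.≡ᵇ 0)) (λ y → F (L y)))))
           (trans (Σℕ-cong a (λ s s<a → trans (cong (λ e → indicator e * F (P s)) (adj-P-P t<a s<a))
                                              (trans (cong (_* F (P s)) (indicator-adjacent t s))
                                                     (ℚP.*-distribʳ-+ (F (P s)) (indicator (s ℕ.≡ᵇ suc t)) _))))
                  (Σℕ-distrib-+ a (λ s → indicator (s ℕ.≡ᵇ suc t) * F (P s)) (λ s → indicator (suc s ℕ.≡ᵇ t) * F (P s)))))
           (trans (Σℕ-cong c (λ v v<c → cong (λ e → indicator e * F (R v)) (adj-P-R t<a v<c)))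
                  (sym (*-distribˡ-Σℕ c (indicator (suc t ℕ.≡ᵇ a)) (λ v → F (R v))))) ⟩
    indicator (t ℕ.≡ᵇ 0) * ΣL F
      + (Σℕ a (λ s → indicator (s ℕ.≡ᵇ suc t) * F (P s)) + Σℕ a (λ s → indicator (suc s ℕ.≡ᵇ t) * F (P s)))
      + indicator (suc t ℕ.≡ᵇ a) * ΣR F ∎

  neighbourSum-P₀ : ∀ F → neighbourSum (b ℕ.+ 0) F ≡ ΣL F + F (P 1)
  neighbourSum-P₀ F = begin
    neighbourSum (b ℕ.+ 0) F
      ≡⟨ neighbourSum-P z<s F ⟩
    1ℚ * ΣL F + (Σℕ a (λ s → indicator (s ℕ.≡ᵇ 1) * F (P s)) + Σℕ a (λ s → 0ℚ * F (P s))) + 0ℚ * ΣR F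
      ≡⟨ cong₂ (λ p q → 1ℚ * ΣL F + (p + q) + 0ℚ * ΣR F)
           (Σℕ-δ {a} (s≤s (s≤s z≤n)) (λ s → F (P s))) (Σℕ-zeroˡ a (λ s → F (P s))) ⟩
    1ℚ * ΣL F + (F (P 1) + 0ℚ) + 0ℚ * ΣR F
      ≡⟨ simplify (ΣL F) (F (P 1)) (ΣR F) ⟩
    ΣL F + F (P 1) ∎
    where
    simplify : ∀ x y z → 1ℚ * x + (y + 0ℚ) + 0ℚ * z ≡ x + y
    simplify = solve-∀ ℚ-ring

  neighbourSum-Pᵢ : ∀ {t} → t < l → ∀ F → neighbourSum (b ℕ.+ suc t) F ≡ F (P (suc (suc t))) + F (P t)
  neighbourSum-Pᵢ {t} t<l F = begin
    neighbourSum (b ℕ.+ suc t) F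
      ≡⟨ neighbourSum-P (ℕP.<-trans (ℕP.n<1+n (suc t)) t+2<a) F ⟩
    0ℚ * ΣL F + (Σℕ a (λ s → indicator (s ℕ.≡ᵇ suc (suc t)) * F (P s)) + Σℕ a (λ s → indicator (s ℕ.≡ᵇ t) * F (P s)))
      + indicator (t ℕ.≡ᵇ l) * ΣR F
      ≡⟨ cong₂ (λ p q → 0ℚ * ΣL F + p + indicator q * ΣR F)
           (cong₂ _+_ (Σℕ-δ t+2<a (λ s → F (P s))) (Σℕ-δ {a} (ℕP.m<n⇒m<1+n (ℕP.m<n⇒m<1+n t<l)) (λ s → F (P s))))
           (≡ᵇ-false (ℕP.<⇒≢ t<l)) ⟩
    0ℚ * ΣL F + (F (P (suc (suc t))) + F (P t)) + 0ℚ * ΣR F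
      ≡⟨ simplify (ΣL F) (F (P (suc (suc t))) + F (P t)) (ΣR F) ⟩
    F (P (suc (suc t))) + F (P t) ∎
    where
    t+2<a : suc (suc t) < a
    t+2<a = s≤s (s≤s t<l)
    simplify : ∀ x y z → 0ℚ * x + y + 0ℚ * z ≡ y
    simplify = solve-∀ ℚ-ring

  neighbourSum-Pₑ : ∀ F → neighbourSum (b ℕ.+ suc l) F ≡ F (P l) + ΣR F
  neighbourSum-Pₑ F = begin
    neighbourSum (b ℕ.+ suc l) F
      ≡⟨ neighbourSum-P ℕP.≤-refl F ⟩
    0ℚ * ΣL F + (Σℕ a (λ s → indicator (s ℕ.≡ᵇ suc (suc l)) * F (P s)) + Σℕ a (λ s → indicator (s ℕ.≡ᵇ l) * F (P s)))
      + indicator (l ℕ.≡ᵇ l) * ΣR F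
      ≡⟨ cong₂ (λ p q → 0ℚ * ΣL F + p + indicator q * ΣR F)
           (cong₂ _+_ (Σℕ-δ-out {a} ℕP.≤-refl (λ s → F (P s))) (Σℕ-δ {a} (ℕP.m<n⇒m<1+n (ℕP.n<1+n l)) (λ s → F (P s))))
           (≡ᵇ-refl l) ⟩
    0ℚ * ΣL F + (0ℚ + F (P l)) + 1ℚ * ΣR F
      ≡⟨ simplify (ΣL F) (F (P l)) (ΣR F) ⟩
    F (P l) + ΣR F ∎
    where
    simplify : ∀ x y z → 0ℚ * x + (0ℚ + y) + 1ℚ * z ≡ y + z
    simplify = solve-∀ ℚ-ring

  neighbourSum-R : ∀ {u} → u < c → ∀ F → neighbourSum (b ℕ.+ a ℕ.+ u) F ≡ F (P (suc l)) + (ΣR F - F (R u))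
  neighbourSum-R {u} u<c F = begin
    neighbourSum (b ℕ.+ a ℕ.+ u) F
      ≡⟨ neighbourSum-blocks (b ℕ.+ a ℕ.+ u) F ⟩
    Σℕ b (λ y → indicator (adjℕ (b ℕ.+ a ℕ.+ u) y) * F (L y))
      + Σℕ a (λ s → indicator (adjℕ (b ℕ.+ a ℕ.+ u) (b ℕ.+ s)) * F (P s))
      + Σℕ c (λ v → indicator (adjℕ (b ℕ.+ a ℕ.+ u) (b ℕ.+ a ℕ.+ v)) * F (R v))
      ≡⟨ cong₂ _+_ (cong₂ _+_
           (trans (Σℕ-cong b (λ y y<b → cong (λ e → indicator e * F (L y)) (adj-R-L u<c y<b))) (Σℕ-zeroˡ b (λ y → F (L y))))
           (trans (Σℕ-cong a (λ s s<a → cong (λ e → indicator e * F (P s)) (adj-R-P u<c s<a)))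
                  (Σℕ-δ {a} ℕP.≤-refl (λ s → F (P s)))))
           (trans (Σℕ-cong c (λ v v<c → cong (λ e → indicator e * F (R v)) (adj-R-R u<c v<c)))
                  (Σℕ-delete u<c (λ v → F (R v)))) ⟩
    0ℚ + F (P (suc l)) + (ΣR F - F (R u))
      ≡⟨ cong (λ s → s + (ΣR F - F (R u))) (ℚP.+-identityˡ (F (P (suc l)))) ⟩
    F (P (suc l)) + (ΣR F - F (R u)) ∎

  B C E B₁ C₁ κ : ℚ
  B = b × 1ℚ
  C = c × 1ℚ
  E = suc l × 1ℚ
  B₁ = 1ℚ + B
  C₁ = 1ℚ + C
  κ = B₁ * C₁

  -- κ times the effective resistance: 2/(b+1) across K_{b+1}, 2/(c+1) across K_{c+1}, and the
  -- distance along the path.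
  ρ : Vertex → Vertex → ℚ
  ρ (L x) (L y) = 2 × 1ℚ * C₁ * (1ℚ - indicator (x ℕ.≡ᵇ y))
  ρ (L x) (P s) = 2 × 1ℚ * C₁ + κ * s × 1ℚ
  ρ (L x) (R v) = 2 × 1ℚ * C₁ + κ * E + 2 × 1ℚ * B₁
  ρ (P t) (L y) = 2 × 1ℚ * C₁ + κ * t × 1ℚ
  ρ (P t) (P s) = κ * ℕ.∣ t - s ∣ × 1ℚ
  ρ (P t) (R v) = κ * (E - t × 1ℚ) + 2 × 1ℚ * B₁
  ρ (R u) (L y) = 2 × 1ℚ * C₁ + κ * E + 2 × 1ℚ * B₁
  ρ (R u) (P s) = κ * (E - s × 1ℚ) + 2 × 1ℚ * B₁
  ρ (R u) (R v) = 2 × 1ℚ * B₁ * (1ℚ - indicator (u ℕ.≡ᵇ v))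

  degree : Vertex → ℚ
  degree (L _) = B
  degree (P t) = 2 × 1ℚ + (B - 1ℚ) * indicator (t ℕ.≡ᵇ 0) + (C - 1ℚ) * indicator (t ℕ.≡ᵇ suc l)
  degree (R _) = C

  β : Vertex → ℚ
  β (L _) = 2 × 1ℚ * C₁
  β (P t) = C₁ * (1ℚ - B) * indicator (t ℕ.≡ᵇ 0) + B₁ * (1ℚ - C) * indicator (t ℕ.≡ᵇ suc l)
  β (R _) = 2 × 1ℚ * B₁

  Δρ : ℕ → Vertex → Vertex → ℚ
  Δρ x X Y = degree X * ρ X Y - neighbourSum x (λ Z → ρ Z Y)

  ΣL-ρ-L : ∀ {y} → y < b → ΣL (λ Z → ρ Z (L y)) ≡ 2 × 1ℚ * C₁ * (B - 1ℚ)
  ΣL-ρ-L y<b = Σℕ-offDiagonal y<b (2 × 1ℚ * C₁)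

  ΣR-ρ-R : ∀ {v} → v < c → ΣR (λ Z → ρ Z (R v)) ≡ 2 × 1ℚ * B₁ * (C - 1ℚ)
  ΣR-ρ-R v<c = Σℕ-offDiagonal v<c (2 × 1ℚ * B₁)

  ρ-sym : ∀ X Y → ρ X Y ≡ ρ Y X
  ρ-sym (L x) (L y) = cong (λ e → 2 × 1ℚ * C₁ * (1ℚ - indicator e)) (≡ᵇ-sym x y)
  ρ-sym (L x) (P s) = refl
  ρ-sym (L x) (R v) = refl
  ρ-sym (P t) (L y) = refl
  ρ-sym (P t) (P s) = cong (λ n → κ * n × 1ℚ) (ℕP.∣-∣-comm t s)
  ρ-sym (P t) (R v) = refl
  ρ-sym (R u) (L y) = refl
  ρ-sym (R u) (P s) = refl
  ρ-sym (R u) (R v) = cong (λ e → 2 × 1ℚ * B₁ * (1ℚ - indicator e)) (≡ᵇ-sym u v)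

  ρ-diag : ∀ X → ρ X X ≡ 0ℚ
  ρ-diag (L x) = trans (cong (λ e → 2 × 1ℚ * C₁ * (1ℚ - indicator e)) (≡ᵇ-refl x)) (ℚP.*-zeroʳ (2 × 1ℚ * C₁))
  ρ-diag (P t) = trans (cong (λ n → κ * n × 1ℚ) (ℕP.∣n-n∣≡0 t)) (ℚP.*-zeroʳ κ)
  ρ-diag (R u) = trans (cong (λ e → 2 × 1ℚ * B₁ * (1ℚ - indicator e)) (≡ᵇ-refl u)) (ℚP.*-zeroʳ (2 × 1ℚ * B₁))

  degree-P₀ : degree (P 0) ≡ B₁
  degree-P₀ = identity B C
    where
    identity : ∀ B C → 2 × 1ℚ + (B - 1ℚ) * 1ℚ + (C - 1ℚ) * 0ℚ ≡ 1ℚ + B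
    identity = solve-∀ ℚ-ring

  β-P₀ : β (P 0) ≡ C₁ * (1ℚ - B)
  β-P₀ = identity B C
    where
    identity : ∀ B C → let B₁ = 1ℚ + B ; C₁ = 1ℚ + C in C₁ * (1ℚ - B) * 1ℚ + B₁ * (1ℚ - C) * 0ℚ ≡ C₁ * (1ℚ - B)
    identity = solve-∀ ℚ-ring

  degree-Pᵢ : ∀ {t} → t < l → degree (P (suc t)) ≡ 2 × 1ℚ
  degree-Pᵢ {t} t<l = trans (cong (λ e → 2 × 1ℚ + (B - 1ℚ) * 0ℚ + (C - 1ℚ) * indicator e) (≡ᵇ-false (ℕP.<⇒≢ t<l)))
                            (identity B C)
    where
    identity : ∀ B C → 2 × 1ℚ + (B - 1ℚ) * 0ℚ + (C - 1ℚ) * 0ℚ ≡ 2 × 1ℚ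
    identity = solve-∀ ℚ-ring

  β-Pᵢ : ∀ {t} → t < l → β (P (suc t)) ≡ 0ℚ
  β-Pᵢ {t} t<l = trans (cong (λ e → C₁ * (1ℚ - B) * 0ℚ + B₁ * (1ℚ - C) * indicator e) (≡ᵇ-false (ℕP.<⇒≢ t<l)))
                       (identity B C)
    where
    identity : ∀ B C → let B₁ = 1ℚ + B ; C₁ = 1ℚ + C in C₁ * (1ℚ - B) * 0ℚ + B₁ * (1ℚ - C) * 0ℚ ≡ 0ℚ
    identity = solve-∀ ℚ-ring

  degree-Pₑ : degree (P (suc l)) ≡ C₁
  degree-Pₑ = trans (cong (λ e → 2 × 1ℚ + (B - 1ℚ) * 0ℚ + (C - 1ℚ) * indicator e) (≡ᵇ-refl l)) (identity B C)
    where
    identity : ∀ B C → 2 × 1ℚ + (B - 1ℚ) * 0ℚ + (C - 1ℚ) * 1ℚ ≡ 1ℚ + C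
    identity = solve-∀ ℚ-ring

  β-Pₑ : β (P (suc l)) ≡ B₁ * (1ℚ - C)
  β-Pₑ = trans (cong (λ e → C₁ * (1ℚ - B) * 0ℚ + B₁ * (1ℚ - C) * indicator e) (≡ᵇ-refl l)) (identity B C)
    where
    identity : ∀ B C → let B₁ = 1ℚ + B ; C₁ = 1ℚ + C in C₁ * (1ℚ - B) * 0ℚ + B₁ * (1ℚ - C) * 1ℚ ≡ B₁ * (1ℚ - C)
    identity = solve-∀ ℚ-ring

  Δρ-via : ∀ x X Y {d s} → degree X ≡ d → neighbourSum x (λ Z → ρ Z Y) ≡ s →
           Δρ x X Y ≡ d * ρ X Y - s
  Δρ-via x X Y = cong₂ (λ d s → d * ρ X Y - s)

  Δρ-L-L : ∀ {x y} → x < b → y < b → Δρ x (L x) (L y) ≡ β (L x) - 2 × 1ℚ * κ * indicator (x ℕ.≡ᵇ y)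
  Δρ-L-L {x} {y} x<b y<b =
    trans (Δρ-via x (L x) (L y) refl
            (trans (neighbourSum-L x<b (λ Z → ρ Z (L y))) (cong (λ q → q - ρ (L x) (L y) + ρ (P 0) (L y)) (ΣL-ρ-L y<b))))
          (identity B C (indicator (x ℕ.≡ᵇ y)))
    where
    identity : ∀ B C d → let B₁ = 1ℚ + B ; C₁ = 1ℚ + C ; κ = B₁ * C₁ in
      B * (2 × 1ℚ * C₁ * (1ℚ - d))
        - (2 × 1ℚ * C₁ * (B - 1ℚ) - 2 × 1ℚ * C₁ * (1ℚ - d) + (2 × 1ℚ * C₁ + κ * 0ℚ))
      ≡ 2 × 1ℚ * C₁ - 2 × 1ℚ * κ * d
    identity = solve-∀ ℚ-ring

  Δρ-L-P : ∀ {x s} → x < b → Δρ x (L x) (P s) ≡ β (L x)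
  Δρ-L-P {x} {s} x<b =
    trans (Δρ-via x (L x) (P s) refl
            (trans (neighbourSum-L x<b (λ Z → ρ Z (P s))) (cong (λ q → q - ρ (L x) (P s) + ρ (P 0) (P s)) (Σℕ-const b _))))
          (identity B C (s × 1ℚ))
    where
    identity : ∀ B C S → let B₁ = 1ℚ + B ; C₁ = 1ℚ + C ; κ = B₁ * C₁ in
      B * (2 × 1ℚ * C₁ + κ * S)
        - (B * (2 × 1ℚ * C₁ + κ * S) - (2 × 1ℚ * C₁ + κ * S)
           + κ * S)
      ≡ 2 × 1ℚ * C₁
    identity = solve-∀ ℚ-ring


  Δρ-L-R : ∀ {x v} → x < b → Δρ x (L x) (R v) ≡ β (L x)
  Δρ-L-R {x} {v} x<b =
    trans (Δρ-via x (L x) (R v) refl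
            (trans (neighbourSum-L x<b (λ Z → ρ Z (R v))) (cong (λ q → q - ρ (L x) (R v) + ρ (P 0) (R v)) (Σℕ-const b _))))
          (identity B C E)
    where
    identity : ∀ B C E → let B₁ = 1ℚ + B ; C₁ = 1ℚ + C ; κ = B₁ * C₁ in
      B * (2 × 1ℚ * C₁ + κ * E + 2 × 1ℚ * B₁)
        - (B * (2 × 1ℚ * C₁ + κ * E + 2 × 1ℚ * B₁)
           - (2 × 1ℚ * C₁ + κ * E + 2 × 1ℚ * B₁)
           + (κ * (E - 0ℚ) + 2 × 1ℚ * B₁))
      ≡ 2 × 1ℚ * C₁
    identity = solve-∀ ℚ-ring

  Δρ-P₀-L : ∀ {y} → y < b → Δρ (b ℕ.+ 0) (P 0) (L y) ≡ β (P 0)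
  Δρ-P₀-L {y} y<b =
    trans (Δρ-via (b ℕ.+ 0) (P 0) (L y) degree-P₀
            (trans (neighbourSum-P₀ (λ Z → ρ Z (L y))) (cong (λ q → q + ρ (P 1) (L y)) (ΣL-ρ-L y<b))))
          (trans (identity B C) (sym β-P₀))
    where
    identity : ∀ B C → let B₁ = 1ℚ + B ; C₁ = 1ℚ + C ; κ = B₁ * C₁ in
      B₁ * (2 × 1ℚ * C₁ + κ * 0ℚ)
        - (2 × 1ℚ * C₁ * (B - 1ℚ) + (2 × 1ℚ * C₁ + κ * (1ℚ + 0ℚ)))
      ≡ C₁ * (1ℚ - B)
    identity = solve-∀ ℚ-ring

  Δρ-P₀-P : ∀ s → Δρ (b ℕ.+ 0) (P 0) (P s) ≡ β (P 0) - 2 × 1ℚ * κ * indicator (0 ℕ.≡ᵇ s)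
  Δρ-P₀-P zero =
    trans (Δρ-via (b ℕ.+ 0) (P 0) (P 0) degree-P₀
            (trans (neighbourSum-P₀ (λ Z → ρ Z (P 0))) (cong (λ q → q + ρ (P 1) (P 0)) (Σℕ-const b _))))
          (trans (identity B C) (cong (λ β₀ → β₀ - 2 × 1ℚ * κ * 1ℚ) (sym β-P₀)))
    where
    identity : ∀ B C → let B₁ = 1ℚ + B ; C₁ = 1ℚ + C ; κ = B₁ * C₁ in
      B₁ * (κ * 0ℚ)
        - (B * (2 × 1ℚ * C₁ + κ * 0ℚ) + κ * (1ℚ + 0ℚ))
      ≡ C₁ * (1ℚ - B) - 2 × 1ℚ * κ * 1ℚ
    identity = solve-∀ ℚ-ring
  Δρ-P₀-P (suc s) =
    trans (Δρ-via (b ℕ.+ 0) (P 0) (P (suc s)) degree-P₀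
            (trans (neighbourSum-P₀ (λ Z → ρ Z (P (suc s)))) (cong (λ q → q + ρ (P 1) (P (suc s))) (Σℕ-const b _))))
          (trans (identity B C (s × 1ℚ)) (cong (λ β₀ → β₀ - 2 × 1ℚ * κ * 0ℚ) (sym β-P₀)))
    where
    identity : ∀ B C S → let B₁ = 1ℚ + B ; C₁ = 1ℚ + C ; κ = B₁ * C₁ in
      B₁ * (κ * (1ℚ + S))
        - (B * (2 × 1ℚ * C₁ + κ * (1ℚ + S)) + κ * S)
      ≡ C₁ * (1ℚ - B) - 2 × 1ℚ * κ * 0ℚ
    identity = solve-∀ ℚ-ring

  Δρ-P₀-R : ∀ {v} → Δρ (b ℕ.+ 0) (P 0) (R v) ≡ β (P 0)
  Δρ-P₀-R {v} =
    trans (Δρ-via (b ℕ.+ 0) (P 0) (R v) degree-P₀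
            (trans (neighbourSum-P₀ (λ Z → ρ Z (R v))) (cong (λ q → q + ρ (P 1) (R v)) (Σℕ-const b _))))
          (trans (identity B C E) (sym β-P₀))
    where
    identity : ∀ B C E → let B₁ = 1ℚ + B ; C₁ = 1ℚ + C ; κ = B₁ * C₁ in
      B₁ * (κ * (E - 0ℚ) + 2 × 1ℚ * B₁)
        - (B * (2 × 1ℚ * C₁ + κ * E + 2 × 1ℚ * B₁)
           + (κ * (E - (1ℚ + 0ℚ)) + 2 × 1ℚ * B₁))
      ≡ C₁ * (1ℚ - B)
    identity = solve-∀ ℚ-ring

  Δρ-Pᵢ-L : ∀ {t y} → t < l → Δρ (b ℕ.+ suc t) (P (suc t)) (L y) ≡ β (P (suc t))
  Δρ-Pᵢ-L {t} {y} t<l =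
    trans (Δρ-via (b ℕ.+ suc t) (P (suc t)) (L y) (degree-Pᵢ t<l) (neighbourSum-Pᵢ t<l (λ Z → ρ Z (L y))))
          (trans (identity B C (t × 1ℚ)) (sym (β-Pᵢ t<l)))
    where
    identity : ∀ B C T → let B₁ = 1ℚ + B ; C₁ = 1ℚ + C ; κ = B₁ * C₁ in
      2 × 1ℚ * (2 × 1ℚ * C₁ + κ * (1ℚ + T))
        - ((2 × 1ℚ * C₁ + κ * (1ℚ + (1ℚ + T))) + (2 × 1ℚ * C₁ + κ * T))
      ≡ 0ℚ
    identity = solve-∀ ℚ-ring

  Δρ-Pᵢ-P : ∀ {t} s → t < l →
    Δρ (b ℕ.+ suc t) (P (suc t)) (P s) ≡ β (P (suc t)) - 2 × 1ℚ * κ * indicator (suc t ℕ.≡ᵇ s)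
  Δρ-Pᵢ-P {t} s t<l = begin
    Δρ (b ℕ.+ suc t) (P (suc t)) (P s)
      ≡⟨ Δρ-via (b ℕ.+ suc t) (P (suc t)) (P s) (degree-Pᵢ t<l) (neighbourSum-Pᵢ t<l (λ Z → ρ Z (P s))) ⟩
    2 × 1ℚ * (κ * D₁) - (κ * D₂ + κ * D₀)
      ≡⟨ cong (λ D → 2 × 1ℚ * (κ * D₁) - (κ * D + κ * D₀)) D₂≡ ⟩
    2 × 1ℚ * (κ * D₁) - (κ * (2 × 1ℚ * D₁ + 2 × 1ℚ * e - D₀) + κ * D₀)
      ≡⟨ identity κ D₀ D₁ e ⟩
    0ℚ - 2 × 1ℚ * κ * e
      ≡⟨ cong (λ β′ → β′ - 2 × 1ℚ * κ * e) (β-Pᵢ t<l) ⟨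
    β (P (suc t)) - 2 × 1ℚ * κ * e ∎
    where
    D₀ D₁ D₂ e : ℚ
    D₀ = ℕ.∣ t - s ∣ × 1ℚ
    D₁ = ℕ.∣ suc t - s ∣ × 1ℚ
    D₂ = ℕ.∣ suc (suc t) - s ∣ × 1ℚ
    e = indicator (suc t ℕ.≡ᵇ s)
    D₂≡ : D₂ ≡ 2 × 1ℚ * D₁ + 2 × 1ℚ * e - D₀
    D₂≡ = trans (x≡x+y-y D₂ D₀) (cong (λ q → q - D₀) (∣-∣-secondDifference t s))
      where
      x≡x+y-y : ∀ x y → x ≡ x + y - y
      x≡x+y-y = solve-∀ ℚ-ring
    identity : ∀ k D₀ D₁ e →
      2 × 1ℚ * (k * D₁) - (k * (2 × 1ℚ * D₁ + 2 × 1ℚ * e - D₀) + k * D₀) ≡ 0ℚ - 2 × 1ℚ * k * e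
    identity = solve-∀ ℚ-ring

  Δρ-Pᵢ-R : ∀ {t v} → t < l → Δρ (b ℕ.+ suc t) (P (suc t)) (R v) ≡ β (P (suc t))
  Δρ-Pᵢ-R {t} {v} t<l =
    trans (Δρ-via (b ℕ.+ suc t) (P (suc t)) (R v) (degree-Pᵢ t<l) (neighbourSum-Pᵢ t<l (λ Z → ρ Z (R v))))
          (trans (identity B C E (t × 1ℚ)) (sym (β-Pᵢ t<l)))
    where
    identity : ∀ B C E T → let B₁ = 1ℚ + B ; C₁ = 1ℚ + C ; κ = B₁ * C₁ in
      2 × 1ℚ * (κ * (E - (1ℚ + T)) + 2 × 1ℚ * B₁)
        - ((κ * (E - (1ℚ + (1ℚ + T))) + 2 × 1ℚ * B₁)
           + (κ * (E - T) + 2 × 1ℚ * B₁))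
      ≡ 0ℚ
    identity = solve-∀ ℚ-ring

  Δρ-Pₑ-L : ∀ {y} → Δρ (b ℕ.+ suc l) (P (suc l)) (L y) ≡ β (P (suc l))
  Δρ-Pₑ-L {y} =
    trans (Δρ-via (b ℕ.+ suc l) (P (suc l)) (L y) degree-Pₑ
            (trans (neighbourSum-Pₑ (λ Z → ρ Z (L y))) (cong (λ q → ρ (P l) (L y) + q) (Σℕ-const c _))))
          (trans (identity B C (l × 1ℚ)) (sym β-Pₑ))
    where
    identity : ∀ B C ℓ → let B₁ = 1ℚ + B ; C₁ = 1ℚ + C ; κ = B₁ * C₁ in
      C₁ * (2 × 1ℚ * C₁ + κ * (1ℚ + ℓ))
        - ((2 × 1ℚ * C₁ + κ * ℓ)
           + C * (2 × 1ℚ * C₁ + κ * (1ℚ + ℓ) + 2 × 1ℚ * B₁))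
      ≡ B₁ * (1ℚ - C)
    identity = solve-∀ ℚ-ring

  Δρ-Pₑ-P : ∀ {s} → s < a →
    Δρ (b ℕ.+ suc l) (P (suc l)) (P s) ≡ β (P (suc l)) - 2 × 1ℚ * κ * indicator (suc l ℕ.≡ᵇ s)
  Δρ-Pₑ-P {s} s<a with ℕP.m≤n⇒m<n∨m≡n (ℕP.≤-pred s<a)
  ... | inj₂ refl = begin
    Δρ (b ℕ.+ suc l) (P (suc l)) (P (suc l))
      ≡⟨ Δρ-via (b ℕ.+ suc l) (P (suc l)) (P (suc l)) degree-Pₑ
           (trans (neighbourSum-Pₑ (λ Z → ρ Z (P (suc l)))) (cong (λ q → ρ (P l) (P (suc l)) + q) (Σℕ-const c _))) ⟩
    C₁ * (κ * ℕ.∣ l - l ∣ × 1ℚ) - (κ * ℕ.∣ l - suc l ∣ × 1ℚ + C * (κ * (E - E) + 2 × 1ℚ * B₁))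
      ≡⟨ cong₂ (λ p q → C₁ * (κ * p) - (κ * q + C * (κ * (E - E) + 2 × 1ℚ * B₁)))
           (cong (_× 1ℚ) (ℕP.∣n-n∣≡0 l)) (∣n-1+n∣×1 l) ⟩
    C₁ * (κ * 0ℚ) - (κ * 1ℚ + C * (κ * (E - E) + 2 × 1ℚ * B₁))
      ≡⟨ identity B C E ⟩
    B₁ * (1ℚ - C) - 2 × 1ℚ * κ * 1ℚ
      ≡⟨ cong₂ (λ β′ e → β′ - 2 × 1ℚ * κ * indicator e) β-Pₑ (≡ᵇ-refl l) ⟨
    β (P (suc l)) - 2 × 1ℚ * κ * indicator (suc l ℕ.≡ᵇ suc l) ∎
    where
    identity : ∀ B C E → let B₁ = 1ℚ + B ; C₁ = 1ℚ + C ; κ = B₁ * C₁ in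
      C₁ * (κ * 0ℚ)
        - (κ * 1ℚ + C * (κ * (E - E) + 2 × 1ℚ * B₁))
      ≡ B₁ * (1ℚ - C) - 2 × 1ℚ * κ * 1ℚ
    identity = solve-∀ ℚ-ring
  ... | inj₁ s≤l = begin
    Δρ (b ℕ.+ suc l) (P (suc l)) (P s)
      ≡⟨ Δρ-via (b ℕ.+ suc l) (P (suc l)) (P s) degree-Pₑ
           (trans (neighbourSum-Pₑ (λ Z → ρ Z (P s))) (cong (λ q → ρ (P l) (P s) + q) (Σℕ-const c _))) ⟩
    C₁ * (κ * ℕ.∣ suc l - s ∣ × 1ℚ) - (κ * ℕ.∣ l - s ∣ × 1ℚ + C * (κ * (E - s × 1ℚ) + 2 × 1ℚ * B₁))
      ≡⟨ cong₂ (λ p q → C₁ * (κ * p) - (κ * q + C * (κ * (E - s × 1ℚ) + 2 × 1ℚ * B₁)))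
           (∣-∣×1 (ℕP.<⇒≤ s≤l)) (∣-∣×1 (ℕP.≤-pred s≤l)) ⟩
    C₁ * (κ * (E - s × 1ℚ)) - (κ * (l × 1ℚ - s × 1ℚ) + C * (κ * (E - s × 1ℚ) + 2 × 1ℚ * B₁))
      ≡⟨ identity B C (l × 1ℚ) (s × 1ℚ) ⟩
    B₁ * (1ℚ - C) - 2 × 1ℚ * κ * 0ℚ
      ≡⟨ cong₂ (λ β′ e → β′ - 2 × 1ℚ * κ * indicator e) β-Pₑ (≡ᵇ-false (ℕP.>⇒≢ s≤l)) ⟨
    β (P (suc l)) - 2 × 1ℚ * κ * indicator (suc l ℕ.≡ᵇ s) ∎
    where
    identity : ∀ B C ℓ S → let B₁ = 1ℚ + B ; C₁ = 1ℚ + C ; κ = B₁ * C₁ in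
      C₁ * (κ * ((1ℚ + ℓ) - S))
        - (κ * (ℓ - S) + C * (κ * ((1ℚ + ℓ) - S) + 2 × 1ℚ * B₁))
      ≡ B₁ * (1ℚ - C) - 2 × 1ℚ * κ * 0ℚ
    identity = solve-∀ ℚ-ring

  Δρ-Pₑ-R : ∀ {v} → v < c → Δρ (b ℕ.+ suc l) (P (suc l)) (R v) ≡ β (P (suc l))
  Δρ-Pₑ-R {v} v<c =
    trans (Δρ-via (b ℕ.+ suc l) (P (suc l)) (R v) degree-Pₑ
            (trans (neighbourSum-Pₑ (λ Z → ρ Z (R v))) (cong (λ q → ρ (P l) (R v) + q) (ΣR-ρ-R v<c))))
          (trans (identity B C (l × 1ℚ)) (sym β-Pₑ))
    where
    identity : ∀ B C ℓ → let B₁ = 1ℚ + B ; C₁ = 1ℚ + C ; κ = B₁ * C₁ in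
      C₁ * (κ * ((1ℚ + ℓ) - (1ℚ + ℓ)) + 2 × 1ℚ * B₁)
        - ((κ * ((1ℚ + ℓ) - ℓ) + 2 × 1ℚ * B₁) + 2 × 1ℚ * B₁ * (C - 1ℚ))
      ≡ B₁ * (1ℚ - C)
    identity = solve-∀ ℚ-ring

  Δρ-R-L : ∀ {u y} → u < c → Δρ (b ℕ.+ a ℕ.+ u) (R u) (L y) ≡ β (R u)
  Δρ-R-L {u} {y} u<c =
    trans (Δρ-via (b ℕ.+ a ℕ.+ u) (R u) (L y) refl
            (trans (neighbourSum-R u<c (λ Z → ρ Z (L y))) (cong (λ q → ρ (P (suc l)) (L y) + (q - ρ (R u) (L y))) (Σℕ-const c _))))
          (identity B C E)
    where
    identity : ∀ B C E → let B₁ = 1ℚ + B ; C₁ = 1ℚ + C ; κ = B₁ * C₁ in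
      C * (2 × 1ℚ * C₁ + κ * E + 2 × 1ℚ * B₁)
        - ((2 × 1ℚ * C₁ + κ * E)
           + (C * (2 × 1ℚ * C₁ + κ * E + 2 × 1ℚ * B₁)
              - (2 × 1ℚ * C₁ + κ * E + 2 × 1ℚ * B₁)))
      ≡ 2 × 1ℚ * B₁
    identity = solve-∀ ℚ-ring

  Δρ-R-P : ∀ {u s} → u < c → s < a → Δρ (b ℕ.+ a ℕ.+ u) (R u) (P s) ≡ β (R u)
  Δρ-R-P {u} {s} u<c s<a = begin
    Δρ (b ℕ.+ a ℕ.+ u) (R u) (P s)
      ≡⟨ Δρ-via (b ℕ.+ a ℕ.+ u) (R u) (P s) refl
           (trans (neighbourSum-R u<c (λ Z → ρ Z (P s))) (cong (λ q → ρ (P (suc l)) (P s) + (q - ρ (R u) (P s))) (Σℕ-const c _))) ⟩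
    C * X - (κ * ℕ.∣ suc l - s ∣ × 1ℚ + (C * X - X))
      ≡⟨ cong (λ p → C * X - (κ * p + (C * X - X))) (∣-∣×1 (ℕP.≤-pred s<a)) ⟩
    C * X - (κ * (E - s × 1ℚ) + (C * X - X))
      ≡⟨ identity B C E (s × 1ℚ) ⟩
    2 × 1ℚ * B₁ ∎
    where
    X = ρ (R u) (P s)
    identity : ∀ B C E S → let B₁ = 1ℚ + B ; C₁ = 1ℚ + C ; κ = B₁ * C₁ in
      C * (κ * (E - S) + 2 × 1ℚ * B₁)
        - (κ * (E - S)
           + (C * (κ * (E - S) + 2 × 1ℚ * B₁) - (κ * (E - S) + 2 × 1ℚ * B₁)))
      ≡ 2 × 1ℚ * B₁
    identity = solve-∀ ℚ-ring

  Δρ-R-R : ∀ {u v} → u < c → v < c →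
    Δρ (b ℕ.+ a ℕ.+ u) (R u) (R v) ≡ β (R u) - 2 × 1ℚ * κ * indicator (u ℕ.≡ᵇ v)
  Δρ-R-R {u} {v} u<c v<c =
    trans (Δρ-via (b ℕ.+ a ℕ.+ u) (R u) (R v) refl
            (trans (neighbourSum-R u<c (λ Z → ρ Z (R v))) (cong (λ q → ρ (P (suc l)) (R v) + (q - ρ (R u) (R v))) (ΣR-ρ-R v<c))))
          (identity B C E (indicator (u ℕ.≡ᵇ v)))
    where
    identity : ∀ B C E d → let B₁ = 1ℚ + B ; C₁ = 1ℚ + C ; κ = B₁ * C₁ in
      C * (2 × 1ℚ * B₁ * (1ℚ - d))
        - ((κ * (E - E) + 2 × 1ℚ * B₁)
           + (2 × 1ℚ * B₁ * (C - 1ℚ) - 2 × 1ℚ * B₁ * (1ℚ - d)))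
      ≡ 2 × 1ℚ * B₁ - 2 × 1ℚ * κ * d
    identity = solve-∀ ℚ-ring

  data PathView : ℕ → Set where
    first : PathView 0
    inner : ∀ {t} → t < l → PathView (suc t)
    last  : PathView (suc l)

  pathView : ∀ {t} → t < a → PathView t
  pathView {zero}  _           = first
  pathView {suc t} (s≤s t<1+l) with ℕP.m≤n⇒m<n∨m≡n (ℕP.≤-pred t<1+l)
  ... | inj₁ t<l  = inner t<l
  ... | inj₂ refl = last

  off-diagonal : ∀ {p q} → p ≡ q → p ≡ q - 2 × 1ℚ * κ * 0ℚ
  off-diagonal {p} {q} p≡q = trans p≡q (x≡x-y*0 q (2 × 1ℚ * κ))
    where
    x≡x-y*0 : ∀ x y → x ≡ x - y * 0ℚ
    x≡x-y*0 = solve-∀ ℚ-ring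

  Δρ-classify : ∀ {x y} → x < N → y < N →
    Δρ x (classify x) (classify y) ≡ β (classify x) - 2 × 1ℚ * κ * indicator (x ℕ.≡ᵇ y)
  Δρ-classify x<N y<N with vertexView x<N | vertexView y<N
  ... | left x<b | left y<b
    rewrite classify-L x<b | classify-L y<b = Δρ-L-L x<b y<b
  ... | left x<b | path {s} s<a
    rewrite classify-L x<b | classify-P s<a | left-≢path x<b s = off-diagonal (Δρ-L-P x<b)
  ... | left x<b | right {v} v<c
    rewrite classify-L x<b | classify-R v<c | left-≢right x<b v = off-diagonal (Δρ-L-R x<b)
  ... | path t<a | left {y} y<b with pathView t<a
  ...   | first
    rewrite classify-P t<a | classify-L y<b | ≡ᵇ-sym (b ℕ.+ 0) y | left-≢path y<b 0 = off-diagonal (Δρ-P₀-L y<b)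
  ...   | inner {t} t<l
    rewrite classify-P t<a | classify-L y<b | ≡ᵇ-sym (b ℕ.+ suc t) y | left-≢path y<b (suc t) = off-diagonal (Δρ-Pᵢ-L t<l)
  ...   | last
    rewrite classify-P t<a | classify-L y<b | ≡ᵇ-sym (b ℕ.+ suc l) y | left-≢path y<b (suc l) = off-diagonal Δρ-Pₑ-L
  Δρ-classify x<N y<N | path t<a | path {s} s<a with pathView t<a
  ...   | first
    rewrite classify-P t<a | classify-P s<a | +-≡ᵇ-+ b {0} {s} = Δρ-P₀-P s
  ...   | inner {t} t<l
    rewrite classify-P t<a | classify-P s<a | +-≡ᵇ-+ b {suc t} {s} = Δρ-Pᵢ-P s t<l
  ...   | last
    rewrite classify-P t<a | classify-P s<a | +-≡ᵇ-+ b {suc l} {s} = Δρ-Pₑ-P s<a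
  Δρ-classify x<N y<N | path t<a | right {v} v<c with pathView t<a
  ...   | first
    rewrite classify-P t<a | classify-R v<c | path-≢right t<a v = off-diagonal Δρ-P₀-R
  ...   | inner t<l
    rewrite classify-P t<a | classify-R v<c | path-≢right t<a v = off-diagonal (Δρ-Pᵢ-R t<l)
  ...   | last
    rewrite classify-P t<a | classify-R v<c | path-≢right t<a v = off-diagonal (Δρ-Pₑ-R v<c)
  Δρ-classify x<N y<N | right {u} u<c | left {y} y<b
    rewrite classify-R u<c | classify-L y<b | ≡ᵇ-sym (b ℕ.+ a ℕ.+ u) y | left-≢right y<b u = off-diagonal (Δρ-R-L u<c)
  Δρ-classify x<N y<N | right {u} u<c | path {s} s<a
    rewrite classify-R u<c | classify-P s<a | ≡ᵇ-sym (b ℕ.+ a ℕ.+ u) (b ℕ.+ s) | path-≢right s<a u = off-diagonal (Δρ-R-P u<c s<a)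
  Δρ-classify x<N y<N | right {u} u<c | right {v} v<c
    rewrite classify-R u<c | classify-R v<c | +-≡ᵇ-+ (b ℕ.+ a) {u} {v} = Δρ-R-R u<c v<c

  G : Graph N
  G = Barbell a b c

  degree-classify : ∀ {x} → x < N → Σℕ N (λ z → indicator (adjℕ x z)) ≡ degree (classify x)
  degree-classify {x} x<N = begin
    Σℕ N (λ z → indicator (adjℕ x z))  ≡⟨ Σℕ-cong N (λ z _ → sym (ℚP.*-identityʳ (indicator (adjℕ x z)))) ⟩
    neighbourSum x (λ _ → 1ℚ)          ≡⟨ by-block (vertexView x<N) ⟩
    degree (classify x)                ∎
    where
    by-block : ∀ {x} → VertexView x → neighbourSum x (λ _ → 1ℚ) ≡ degree (classify x)
    by-block (left {x} x<b) rewrite classify-L x<b = begin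
      neighbourSum x (λ _ → 1ℚ)   ≡⟨ neighbourSum-L x<b (λ _ → 1ℚ) ⟩
      Σℕ b (λ _ → 1ℚ) - 1ℚ + 1ℚ   ≡⟨ cong (λ q → q - 1ℚ + 1ℚ) (Σℕ-const b 1ℚ) ⟩
      B * 1ℚ - 1ℚ + 1ℚ            ≡⟨ identity B ⟩
      B                           ∎
      where
      identity : ∀ B → B * 1ℚ - 1ℚ + 1ℚ ≡ B
      identity = solve-∀ ℚ-ring
    by-block (path t<a) with pathView t<a
    ... | first rewrite classify-P t<a = begin
      neighbourSum (b ℕ.+ 0) (λ _ → 1ℚ)  ≡⟨ neighbourSum-P₀ (λ _ → 1ℚ) ⟩
      Σℕ b (λ _ → 1ℚ) + 1ℚ               ≡⟨ cong (λ q → q + 1ℚ) (Σℕ-const b 1ℚ) ⟩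
      B * 1ℚ + 1ℚ                        ≡⟨ identity B ⟩
      B₁                                 ≡⟨ degree-P₀ ⟨
      degree (P 0)                       ∎
      where
      identity : ∀ B → B * 1ℚ + 1ℚ ≡ 1ℚ + B
      identity = solve-∀ ℚ-ring
    ... | inner {t} t<l rewrite classify-P t<a =
      trans (neighbourSum-Pᵢ t<l (λ _ → 1ℚ)) (sym (degree-Pᵢ t<l))
    ... | last rewrite classify-P t<a = begin
      neighbourSum (b ℕ.+ suc l) (λ _ → 1ℚ)  ≡⟨ neighbourSum-Pₑ (λ _ → 1ℚ) ⟩
      1ℚ + Σℕ c (λ _ → 1ℚ)                   ≡⟨ cong (λ q → 1ℚ + q) (Σℕ-const c 1ℚ) ⟩
      1ℚ + C * 1ℚ                            ≡⟨ cong (λ q → 1ℚ + q) (ℚP.*-identityʳ C) ⟩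
      C₁                                     ≡⟨ degree-Pₑ ⟨
      degree (P (suc l))                     ∎
    by-block (right {u} u<c) rewrite classify-R u<c = begin
      neighbourSum (b ℕ.+ a ℕ.+ u) (λ _ → 1ℚ)  ≡⟨ neighbourSum-R u<c (λ _ → 1ℚ) ⟩
      1ℚ + (Σℕ c (λ _ → 1ℚ) - 1ℚ)              ≡⟨ cong (λ q → 1ℚ + (q - 1ℚ)) (Σℕ-const c 1ℚ) ⟩
      1ℚ + (C * 1ℚ - 1ℚ)                       ≡⟨ identity C ⟩
      C                                        ∎
      where
      identity : ∀ C → 1ℚ + (C * 1ℚ - 1ℚ) ≡ C
      identity = solve-∀ ℚ-ring

  scaledResistance : ScaledResistance G
  scaledResistance = record
    { ρ           = λ u v → ρ (classify (toℕ u)) (classify (toℕ v))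
    ; β           = λ u → β (classify (toℕ u))
    ; scale       = barbellScale B C
    ; scale≢0     = barbellScale≢0 b c
    ; ρ-sym       = λ u v → ρ-sym (classify (toℕ u)) (classify (toℕ v))
    ; ρ-diag      = λ u → ρ-diag (classify (toℕ u))
    ; laplacian-ρ = λ u v →
        trans (cong (λ d → d * ρ (classify (toℕ u)) (classify (toℕ v)) - neighbourSum (toℕ u) (λ Z → ρ Z (classify (toℕ v))))
                    (degree-classify (FinP.toℕ<n u)))
              (Δρ-classify (FinP.toℕ<n u) (FinP.toℕ<n v))
    }

  adj-sym-Fin : ∀ u w → adj G u w ≡ adj G w u
  adj-sym-Fin u w = adj-sym (FinP.toℕ<n u) (FinP.toℕ<n w)

module BarbellSums (l b c : ℕ) where

  open BarbellResistance l b c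
  open BarbellGraph a b c z<s

  ΣP-degree : ∀ (g : ℕ → ℚ) →
    Σℕ a (λ t → g t * degree (P t)) ≡ 2 × 1ℚ * Σℕ a g + (B - 1ℚ) * g 0 + (C - 1ℚ) * g (suc l)
  ΣP-degree g = begin
    Σℕ a (λ t → g t * degree (P t))
      ≡⟨ Σℕ-cong a (λ t _ → distribute (g t) B C (indicator (t ℕ.≡ᵇ 0)) (indicator (t ℕ.≡ᵇ suc l))) ⟩
    Σℕ a (λ t → 2 × 1ℚ * g t + (B - 1ℚ) * start t + (C - 1ℚ) * end t)
      ≡⟨ Σℕ-distrib-+ a (λ t → 2 × 1ℚ * g t + (B - 1ℚ) * start t) (λ t → (C - 1ℚ) * end t) ⟩
    Σℕ a (λ t → 2 × 1ℚ * g t + (B - 1ℚ) * start t) + Σℕ a (λ t → (C - 1ℚ) * end t)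
      ≡⟨ cong (λ q → q + Σℕ a (λ t → (C - 1ℚ) * end t))
              (Σℕ-distrib-+ a (λ t → 2 × 1ℚ * g t) (λ t → (B - 1ℚ) * start t)) ⟩
    Σℕ a (λ t → 2 × 1ℚ * g t) + Σℕ a (λ t → (B - 1ℚ) * start t) + Σℕ a (λ t → (C - 1ℚ) * end t)
      ≡⟨ cong₂ _+_ (cong₂ _+_ (sym (*-distribˡ-Σℕ a (2 × 1ℚ) g))
                              (trans (sym (*-distribˡ-Σℕ a (B - 1ℚ) start)) (cong ((B - 1ℚ) *_) (Σℕ-δ {a} z<s g))))
                   (trans (sym (*-distribˡ-Σℕ a (C - 1ℚ) end)) (cong ((C - 1ℚ) *_) (Σℕ-δ {a} ℕP.≤-refl g))) ⟩
    2 × 1ℚ * Σℕ a g + (B - 1ℚ) * g 0 + (C - 1ℚ) * g (suc l) ∎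
    where
    start end : ℕ → ℚ
    start t = indicator (t ℕ.≡ᵇ 0) * g t
    end   t = indicator (t ℕ.≡ᵇ suc l) * g t
    distribute : ∀ g B C i j → g * (2 × 1ℚ + (B - 1ℚ) * i + (C - 1ℚ) * j) ≡ 2 × 1ℚ * g + (B - 1ℚ) * (i * g) + (C - 1ℚ) * (j * g)
    distribute = solve-∀ ℚ-ring

  potentialAt : Vertex → ℚ
  potentialAt Y = Σℕ N (λ x → ρ (classify x) Y * degree (classify x))

  potential≡potentialAt : ∀ v → potential adj-sym-Fin scaledResistance v ≡ potentialAt (classify (toℕ v))
  potential≡potentialAt v = Σ-cong N (λ u → cong (ρ (classify (toℕ u)) (classify (toℕ v)) *_) (degree-classify (FinP.toℕ<n u)))

  potentialAt-blocks : ∀ Y → potentialAt Y ≡ ΣL (λ X → ρ X Y) * B + Σℕ a (λ t → ρ (P t) Y * degree (P t)) + ΣR (λ X → ρ X Y) * C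
  potentialAt-blocks Y = trans (Σ-blocks (λ _ X → ρ X Y * degree X))
    (cong₂ _+_ (cong₂ _+_ (sym (*-distribʳ-Σℕ b B (λ x → ρ (L x) Y))) refl) (sym (*-distribʳ-Σℕ c C (λ u → ρ (R u) Y))))

  Σt : ℚ
  Σt = sumBelow (a × 1ℚ)

  potentialL : ℚ
  potentialL = 2 × 1ℚ * C₁ * (B - 1ℚ) * B
       + (2 × 1ℚ * (a × 1ℚ * (2 × 1ℚ * C₁) + κ * Σt)
          + (B - 1ℚ) * (2 × 1ℚ * C₁ + κ * 0ℚ) + (C - 1ℚ) * (2 × 1ℚ * C₁ + κ * E))
       + C * (2 × 1ℚ * C₁ + κ * E + 2 × 1ℚ * B₁) * C

  potentialAt-L : ∀ {y} → y < b → potentialAt (L y) ≡ potentialL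
  potentialAt-L {y} y<b = begin
    potentialAt (L y)
      ≡⟨ potentialAt-blocks (L y) ⟩
    ΣL (λ X → ρ X (L y)) * B + Σℕ a (λ t → ρ (P t) (L y) * degree (P t)) + ΣR (λ X → ρ X (L y)) * C
      ≡⟨ cong₂ _+_ (cong₂ _+_ (cong (_* B) (ΣL-ρ-L y<b))
                              (trans (ΣP-degree (λ t → ρ (P t) (L y)))
                                     (cong (λ q → 2 × 1ℚ * q + (B - 1ℚ) * ρ (P 0) (L y) + (C - 1ℚ) * ρ (P (suc l)) (L y))
                                           (Σℕ-affine a (2 × 1ℚ * C₁) κ))))
                   (cong (_* C) (Σℕ-const c _)) ⟩
    2 × 1ℚ * C₁ * (B - 1ℚ) * B
      + (2 × 1ℚ * (a × 1ℚ * (2 × 1ℚ * C₁) + κ * Σt)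
         + (B - 1ℚ) * (2 × 1ℚ * C₁ + κ * 0ℚ) + (C - 1ℚ) * (2 × 1ℚ * C₁ + κ * E))
      + C * (2 × 1ℚ * C₁ + κ * E + 2 × 1ℚ * B₁) * C ∎

  potentialR : ℚ
  potentialR = B * (2 × 1ℚ * C₁ + κ * E + 2 × 1ℚ * B₁) * B
       + (2 × 1ℚ * (a × 1ℚ * (κ * E + 2 × 1ℚ * B₁) + - κ * Σt)
          + (B - 1ℚ) * (κ * (E - 0ℚ) + 2 × 1ℚ * B₁) + (C - 1ℚ) * (κ * (E - E) + 2 × 1ℚ * B₁))
       + 2 × 1ℚ * B₁ * (C - 1ℚ) * C

  potentialAt-R : ∀ {v} → v < c → potentialAt (R v) ≡ potentialR
  potentialAt-R {v} v<c = begin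
    potentialAt (R v)
      ≡⟨ potentialAt-blocks (R v) ⟩
    ΣL (λ X → ρ X (R v)) * B + Σℕ a (λ t → ρ (P t) (R v) * degree (P t)) + ΣR (λ X → ρ X (R v)) * C
      ≡⟨ cong₂ _+_ (cong₂ _+_ (cong (_* B) (Σℕ-const b _))
                              (trans (ΣP-degree (λ t → ρ (P t) (R v)))
                                     (cong (λ q → 2 × 1ℚ * q + (B - 1ℚ) * ρ (P 0) (R v) + (C - 1ℚ) * ρ (P (suc l)) (R v))
                                           (trans (Σℕ-cong a (λ t _ → affine (t × 1ℚ))) (Σℕ-affine a (κ * E + 2 × 1ℚ * B₁) (- κ))))))
                   (cong (_* C) (ΣR-ρ-R v<c)) ⟩
    B * (2 × 1ℚ * C₁ + κ * E + 2 × 1ℚ * B₁) * B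
      + (2 × 1ℚ * (a × 1ℚ * (κ * E + 2 × 1ℚ * B₁) + - κ * Σt)
         + (B - 1ℚ) * (κ * (E - 0ℚ) + 2 × 1ℚ * B₁) + (C - 1ℚ) * (κ * (E - E) + 2 × 1ℚ * B₁))
      + 2 × 1ℚ * B₁ * (C - 1ℚ) * C ∎
    where
    affine : ∀ T → κ * (E - T) + 2 × 1ℚ * B₁ ≡ κ * E + 2 × 1ℚ * B₁ + - κ * T
    affine T = identity κ E (2 × 1ℚ * B₁) T
      where
      identity : ∀ k E x T → k * (E - T) + x ≡ k * E + x + - k * T
      identity = solve-∀ ℚ-ring

  potentialP : ℚ → ℚ
  potentialP S = B * (2 × 1ℚ * C₁ + κ * S) * B
         + (2 × 1ℚ * (κ * (½ * (S * (S + 1ℚ) + (E - S) * (E - S + 1ℚ)))) + (B - 1ℚ) * (κ * S) + (C - 1ℚ) * (κ * (E - S)))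
         + C * (κ * (E - S) + 2 × 1ℚ * B₁) * C

  potentialAt-P : ∀ {s} → s < a → potentialAt (P s) ≡ potentialP (s × 1ℚ)
  potentialAt-P {s} s<a = begin
    potentialAt (P s)
      ≡⟨ potentialAt-blocks (P s) ⟩
    ΣL (λ X → ρ X (P s)) * B + Σℕ a (λ t → ρ (P t) (P s) * degree (P t)) + ΣR (λ X → ρ X (P s)) * C
      ≡⟨ cong₂ _+_ (cong₂ _+_ (cong (_* B) (Σℕ-const b _))
                              (trans (ΣP-degree (λ t → ρ (P t) (P s)))
                                     (cong₂ (λ p q → 2 × 1ℚ * p + (B - 1ℚ) * (κ * s × 1ℚ) + (C - 1ℚ) * (κ * q))
                                            (trans (sym (*-distribˡ-Σℕ a κ (λ t → ℕ.∣ t - s ∣ × 1ℚ)))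
                                                   (cong (κ *_) (Σℕ-distance (ℕP.≤-pred s<a))))
                                            (∣-∣×1 (ℕP.≤-pred s<a)))))
                   (cong (_* C) (Σℕ-const c _)) ⟩
    B * (2 × 1ℚ * C₁ + κ * s × 1ℚ) * B
      + (2 × 1ℚ * (κ * (½ * (s × 1ℚ * (s × 1ℚ + 1ℚ) + (E - s × 1ℚ) * (E - s × 1ℚ + 1ℚ))))
         + (B - 1ℚ) * (κ * s × 1ℚ) + (C - 1ℚ) * (κ * (E - s × 1ℚ)))
      + C * (κ * (E - s × 1ℚ) + 2 × 1ℚ * B₁) * C ∎

  slope : ℚ
  slope = κ * (B * B - 2 × 1ℚ * E + (B - 1ℚ) - (C - 1ℚ) - C * C)

  potentialP-quadratic : ∀ S → potentialP S ≡ potentialP 0ℚ + slope * S + 2 × 1ℚ * κ * (S * S)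
  potentialP-quadratic S = identity B C E S
    where
    identity : ∀ B C E S → let B₁ = 1ℚ + B ; C₁ = 1ℚ + C ; κ = B₁ * C₁
                               potentialP = λ S → B * (2 × 1ℚ * C₁ + κ * S) * B
                                           + (2 × 1ℚ * (κ * (½ * (S * (S + 1ℚ) + (E - S) * (E - S + 1ℚ))))
                                              + (B - 1ℚ) * (κ * S) + (C - 1ℚ) * (κ * (E - S)))
                                           + C * (κ * (E - S) + 2 × 1ℚ * B₁) * C
                           in potentialP S ≡ potentialP 0ℚ + κ * (B * B - 2 × 1ℚ * E + (B - 1ℚ) - (C - 1ℚ) - C * C) * S + 2 × 1ℚ * κ * (S * S)
    identity = solve-∀ ℚ-ring

  Σt² : ℚ
  Σt² = sumSquaresBelow (a × 1ℚ)

  pathPotentialSum : ℚ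
  pathPotentialSum = a × 1ℚ * potentialP 0ℚ + slope * Σt + 2 × 1ℚ * κ * Σt²

  Σ-potentialAt-P : Σℕ a (λ s → potentialAt (P s)) ≡ pathPotentialSum
  Σ-potentialAt-P = trans (Σℕ-cong a (λ s s<a → trans (potentialAt-P s<a) (potentialP-quadratic (s × 1ℚ))))
                          (Σℕ-quadratic a (potentialP 0ℚ) slope (2 × 1ℚ * κ))

  resistanceSum-blocks : Σ N (λ j → deg G j * potential adj-sym-Fin scaledResistance j)
    ≡ B * (B * potentialL)
      + (2 × 1ℚ * pathPotentialSum + (B - 1ℚ) * potentialP 0ℚ + (C - 1ℚ) * potentialP E)
      + C * (C * potentialR)
  resistanceSum-blocks = begin
    Σ N (λ j → deg G j * potential adj-sym-Fin scaledResistance j)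
      ≡⟨ Σ-cong N (λ j → cong₂ _*_ (degree-classify (FinP.toℕ<n j)) (potential≡potentialAt j)) ⟩
    Σℕ N (λ y → degree (classify y) * potentialAt (classify y))
      ≡⟨ Σ-blocks (λ _ Y → degree Y * potentialAt Y) ⟩
    Σℕ b (λ y → B * potentialAt (L y)) + Σℕ a (λ s → degree (P s) * potentialAt (P s)) + Σℕ c (λ v → C * potentialAt (R v))
      ≡⟨ cong₂ _+_ (cong₂ _+_ (trans (Σℕ-cong b (λ y y<b → cong (B *_) (potentialAt-L y<b))) (Σℕ-const b (B * potentialL)))
                              path-part)
                   (trans (Σℕ-cong c (λ v v<c → cong (C *_) (potentialAt-R v<c))) (Σℕ-const c (C * potentialR))) ⟩
    B * (B * potentialL)
      + (2 × 1ℚ * pathPotentialSum + (B - 1ℚ) * potentialP 0ℚ + (C - 1ℚ) * potentialP E)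
      + C * (C * potentialR) ∎
    where
    path-part : Σℕ a (λ s → degree (P s) * potentialAt (P s))
      ≡ 2 × 1ℚ * pathPotentialSum + (B - 1ℚ) * potentialP 0ℚ + (C - 1ℚ) * potentialP E
    path-part = begin
      Σℕ a (λ s → degree (P s) * potentialAt (P s))
        ≡⟨ Σℕ-cong a (λ s _ → ℚP.*-comm (degree (P s)) (potentialAt (P s))) ⟩
      Σℕ a (λ s → potentialAt (P s) * degree (P s))
        ≡⟨ ΣP-degree (λ s → potentialAt (P s)) ⟩
      2 × 1ℚ * Σℕ a (λ s → potentialAt (P s)) + (B - 1ℚ) * potentialAt (P 0) + (C - 1ℚ) * potentialAt (P (suc l))
        ≡⟨ cong₃ (λ p q r → 2 × 1ℚ * p + (B - 1ℚ) * q + (C - 1ℚ) * r)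
                 Σ-potentialAt-P (potentialAt-P z<s) (potentialAt-P ℕP.≤-refl) ⟩
      2 × 1ℚ * pathPotentialSum + (B - 1ℚ) * potentialP 0ℚ + (C - 1ℚ) * potentialP E ∎

  twiceEdges-closed : twiceEdges G ≡ barbellTwiceEdges B C E
  twiceEdges-closed = begin
    Σ N (deg G)
      ≡⟨ Σ-cong N (λ u → degree-classify (FinP.toℕ<n u)) ⟩
    Σℕ N (λ x → degree (classify x))
      ≡⟨ Σ-blocks (λ _ X → degree X) ⟩
    Σℕ b (λ _ → B) + Σℕ a (λ t → degree (P t)) + Σℕ c (λ _ → C)
      ≡⟨ cong₂ _+_ (cong₂ _+_ (Σℕ-const b B) path-degrees) (Σℕ-const c C) ⟩
    B * B + (2 × 1ℚ * (a × 1ℚ * 1ℚ) + (B - 1ℚ) * 1ℚ + (C - 1ℚ) * 1ℚ) + C * C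
      ≡⟨ identity B C E ⟩
    barbellTwiceEdges B C E ∎
    where
    identity : ∀ B C E → B * B + (2 × 1ℚ * ((1ℚ + E) * 1ℚ) + (B - 1ℚ) * 1ℚ + (C - 1ℚ) * 1ℚ) + C * C
                         ≡ B * B + C * C + B + C + 2 × 1ℚ * E
    identity = solve-∀ ℚ-ring
    path-degrees : Σℕ a (λ t → degree (P t)) ≡ 2 × 1ℚ * (a × 1ℚ * 1ℚ) + (B - 1ℚ) * 1ℚ + (C - 1ℚ) * 1ℚ
    path-degrees = begin
      Σℕ a (λ t → degree (P t))          ≡⟨ Σℕ-cong a (λ t _ → sym (ℚP.*-identityˡ (degree (P t)))) ⟩
      Σℕ a (λ t → 1ℚ * degree (P t))     ≡⟨ ΣP-degree (λ _ → 1ℚ) ⟩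
      2 × 1ℚ * Σℕ a (λ _ → 1ℚ) + (B - 1ℚ) * 1ℚ + (C - 1ℚ) * 1ℚ
        ≡⟨ cong (λ q → 2 × 1ℚ * q + (B - 1ℚ) * 1ℚ + (C - 1ℚ) * 1ℚ) (Σℕ-const a 1ℚ) ⟩
      2 × 1ℚ * (a × 1ℚ * 1ℚ) + (B - 1ℚ) * 1ℚ + (C - 1ℚ) * 1ℚ ∎

  resistanceSum-closed : Σ N (λ j → deg G j * potential adj-sym-Fin scaledResistance j) ≡ barbellResistanceSum B C E
  resistanceSum-closed = trans resistanceSum-blocks (identity B C E)
    where
    identity : ∀ B C E →
      let B₁ = 1ℚ + B ; C₁ = 1ℚ + C ; κ = B₁ * C₁ ; A = 1ℚ + E ; Dp = B + C + 2 × 1ℚ * E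
          Σt = ½ * (A * (A - 1ℚ))
          Σt² = inv (6 × 1ℚ) * ((A - 1ℚ) * A * (2 × 1ℚ * A - 1ℚ))
          slope = κ * (B * B - 2 × 1ℚ * E + (B - 1ℚ) - (C - 1ℚ) - C * C)
          potentialL = 2 × 1ℚ * C₁ * (B - 1ℚ) * B
               + (2 × 1ℚ * (A * (2 × 1ℚ * C₁) + κ * Σt)
                  + (B - 1ℚ) * (2 × 1ℚ * C₁ + κ * 0ℚ) + (C - 1ℚ) * (2 × 1ℚ * C₁ + κ * E))
               + C * (2 × 1ℚ * C₁ + κ * E + 2 × 1ℚ * B₁) * C
          potentialR = B * (2 × 1ℚ * C₁ + κ * E + 2 × 1ℚ * B₁) * B
               + (2 × 1ℚ * (A * (κ * E + 2 × 1ℚ * B₁) + - κ * Σt)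
                  + (B - 1ℚ) * (κ * (E - 0ℚ) + 2 × 1ℚ * B₁) + (C - 1ℚ) * (κ * (E - E) + 2 × 1ℚ * B₁))
               + 2 × 1ℚ * B₁ * (C - 1ℚ) * C
          potentialP = λ S → B * (2 × 1ℚ * C₁ + κ * S) * B
                     + (2 × 1ℚ * (κ * (½ * (S * (S + 1ℚ) + (E - S) * (E - S + 1ℚ))))
                        + (B - 1ℚ) * (κ * S) + (C - 1ℚ) * (κ * (E - S)))
                     + C * (κ * (E - S) + 2 × 1ℚ * B₁) * C
      in B * (B * potentialL)
         + (2 × 1ℚ * (A * potentialP 0ℚ + slope * Σt + 2 × 1ℚ * κ * Σt²)
            + (B - 1ℚ) * potentialP 0ℚ + (C - 1ℚ) * potentialP E)
         + C * (C * potentialR)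
         ≡ 2 × 1ℚ * C₁ * (B * B * B) * (B - 1ℚ) + 2 × 1ℚ * B₁ * (C * C * C) * (C - 1ℚ)
           + 2 × 1ℚ * (B * B * (2 × 1ℚ * C₁ * Dp + κ * (C₁ * E + E * (E - 1ℚ)))
                       + C * C * (2 × 1ℚ * B₁ * Dp + κ * (B₁ * E + E * (E - 1ℚ)))
                       + B * B * (C * C) * (2 × 1ℚ * C₁ + 2 × 1ℚ * B₁ + κ * E))
           + κ * (4 × 1ℚ * inv (3 × 1ℚ) * (E * (E + 1ℚ) * (E + 2 × 1ℚ)) + 2 × 1ℚ * (E * (E + 1ℚ)) * (B + C - 2 × 1ℚ)
                  + 2 × 1ℚ * ((B - 1ℚ) * (C - 1ℚ)) * E)
    identity = solve-∀ ℚ-ring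

kemenyFrom-barbell : ∀ a b c → 2 ≤ a → ∀ {m} → IsHittingTimes (Barbell a b c) m → ∀ i →
  kemenyFrom (Barbell a b c) m i ≡ barbellKemeny (b × 1ℚ) (c × 1ℚ) ((a ∸ 1) × 1ℚ)
kemenyFrom-barbell (suc (suc l)) b c (s≤s (s≤s z≤n)) {m} hit i = begin
  kemenyFrom G m i
    ≡⟨ kemenyFrom-scaledResistance adj-sym-Fin scaledResistance hit i ⟩
  inv (twiceEdges G) * (inv (barbellScale B C) * Σ N (λ j → deg G j * potential adj-sym-Fin scaledResistance j))
    ≡⟨ cong₂ (λ t s → inv t * (inv (barbellScale B C) * s)) twiceEdges-closed resistanceSum-closed ⟩
  barbellKemeny (b × 1ℚ) (c × 1ℚ) (suc l × 1ℚ) ∎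
  where
  open BarbellResistance l b c
  open BarbellSums l b c

square×1 : ∀ m → (m ^ 2) × 1ℚ ≡ m × 1ℚ * (m × 1ℚ * 1 × 1ℚ)
square×1 m = trans (×1-homo-* m (m ^ 1)) (cong (m × 1ℚ *_) (×1-homo-* m 1))

cube×1 : ∀ m → (m ^ 3) × 1ℚ ≡ m × 1ℚ * (m × 1ℚ * (m × 1ℚ * 1 × 1ℚ))
cube×1 m = trans (×1-homo-* m (m ^ 2)) (cong (m × 1ℚ *_) (square×1 m))

barbellKemeny-corollary : ∀ n k → 6 ≤ n → n ≡ k ℕ.* 3 →
  barbellKemeny ((k ∸ 1) × 1ℚ) ((k ∸ 1) × 1ℚ) ((k ℕ.+ 2 ∸ 1) × 1ℚ)
    ≡ inv (ℕ→ℚ 54) *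
      (ℕ→ℚ (n ^ 3) + ℕ→ℚ (3 ℕ.* n ^ 2) + ℕ→ℚ (60 ℕ.* n) - ℕ→ℚ 270
        + (ℕ→ℚ (297 ℕ.* n ^ 2) - ℕ→ℚ (729 ℕ.* n) + ℕ→ℚ 5832) * inv (ℕ→ℚ (n ^ 3 ℕ.+ 9 ℕ.* n)))
barbellKemeny-corollary n zero          () refl
barbellKemeny-corollary n (suc zero)    (s≤s (s≤s (s≤s ()))) refl
barbellKemeny-corollary n (suc (suc q)) _ refl = begin
  barbellKemeny B B (1ℚ + (q ℕ.+ 2) × 1ℚ)
    ≡⟨ cong (λ x → barbellKemeny B B (1ℚ + x)) (×-homo-+ 1ℚ q 2) ⟩
  barbellKemeny B B E
    ≡⟨ inv-cross-multiply {x = X} {y = Y} {h = H}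
         twiceEdges≢0 (barbellScale≢0 (suc q) (suc q)) (ℕ→ℚ-≢0 54) H≢0 (identity Q) ⟩
  inv (ℕ→ℚ 54) * (X + Y * inv H)
    ≡⟨ cong₂ (λ x y → inv (ℕ→ℚ 54) * (x + y)) (sym X≡) (cong₂ (λ y h → y * inv h) (sym Y≡) (sym H≡)) ⟩
  inv (ℕ→ℚ 54) *
    (ℕ→ℚ (n ^ 3) + ℕ→ℚ (3 ℕ.* n ^ 2) + ℕ→ℚ (60 ℕ.* n) - ℕ→ℚ 270
      + (ℕ→ℚ (297 ℕ.* n ^ 2) - ℕ→ℚ (729 ℕ.* n) + ℕ→ℚ 5832) * inv (ℕ→ℚ (n ^ 3 ℕ.+ 9 ℕ.* n))) ∎
  where
  Q B E N X Y H : ℚ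
  Q = q × 1ℚ
  B = 1ℚ + Q
  E = 1ℚ + (Q + 2 × 1ℚ)
  N = (1ℚ + (1ℚ + Q)) * 3 × 1ℚ
  X = N * (N * (N * 1 × 1ℚ)) + 3 × 1ℚ * (N * (N * 1 × 1ℚ)) + 60 × 1ℚ * N - ℕ→ℚ 270
  Y = 297 × 1ℚ * (N * (N * 1 × 1ℚ)) - 729 × 1ℚ * N + ℕ→ℚ 5832
  H = N * (N * (N * 1 × 1ℚ)) + 9 × 1ℚ * N

  n×1≡N : n × 1ℚ ≡ N
  n×1≡N = ×1-homo-* (suc (suc q)) 3
  n² : ℕ→ℚ (n ^ 2) ≡ N * (N * 1 × 1ℚ)
  n² = trans (ℕ→ℚ≡×1 (n ^ 2)) (trans (square×1 n) (cong (λ x → x * (x * 1 × 1ℚ)) n×1≡N))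
  n³ : ℕ→ℚ (n ^ 3) ≡ N * (N * (N * 1 × 1ℚ))
  n³ = trans (ℕ→ℚ≡×1 (n ^ 3)) (trans (cube×1 n) (cong (λ x → x * (x * (x * 1 × 1ℚ))) n×1≡N))
  scaled : ∀ c m {x} → ℕ→ℚ m ≡ x → ℕ→ℚ (c ℕ.* m) ≡ c × 1ℚ * x
  scaled c m m≡x = trans (ℕ→ℚ≡×1 (c ℕ.* m)) (trans (×1-homo-* c m) (cong (c × 1ℚ *_) (trans (sym (ℕ→ℚ≡×1 m)) m≡x)))
  N≡ : ℕ→ℚ n ≡ N
  N≡ = trans (ℕ→ℚ≡×1 n) n×1≡N

  X≡ : ℕ→ℚ (n ^ 3) + ℕ→ℚ (3 ℕ.* n ^ 2) + ℕ→ℚ (60 ℕ.* n) - ℕ→ℚ 270 ≡ X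
  X≡ = cong₂ (λ p r → p + r - ℕ→ℚ 270) (cong₂ _+_ n³ (scaled 3 (n ^ 2) n²)) (scaled 60 n N≡)
  Y≡ : ℕ→ℚ (297 ℕ.* n ^ 2) - ℕ→ℚ (729 ℕ.* n) + ℕ→ℚ 5832 ≡ Y
  Y≡ = cong₂ (λ p r → p - r + ℕ→ℚ 5832) (scaled 297 (n ^ 2) n²) (scaled 729 n N≡)
  H≡ : ℕ→ℚ (n ^ 3 ℕ.+ 9 ℕ.* n) ≡ H
  H≡ = trans (ℕ→ℚ-+ (n ^ 3) (9 ℕ.* n)) (cong₂ _+_ n³ (scaled 9 n N≡))

  H≢0 : H ≢ 0ℚ
  H≢0 = subst (_≢ 0ℚ) H≡ (ℕ→ℚ-≢0 (n ^ 3 ℕ.+ 9 ℕ.* n))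

  twiceEdges≢0 : barbellTwiceEdges B B E ≢ 0ℚ
  twiceEdges≢0 = subst (_≢ 0ℚ) T≡ (×1-≢0 (2 ℕ.* (k ℕ.* k ℕ.+ 1)))
    where
    k = suc (suc q)
    T≡ : (2 ℕ.* (k ℕ.* k ℕ.+ 1)) × 1ℚ ≡ barbellTwiceEdges B B E
    T≡ = begin
      (2 ℕ.* (k ℕ.* k ℕ.+ 1)) × 1ℚ           ≡⟨ ×1-homo-* 2 (k ℕ.* k ℕ.+ 1) ⟩
      2 × 1ℚ * (k ℕ.* k ℕ.+ 1) × 1ℚ          ≡⟨ cong (2 × 1ℚ *_) (×-homo-+ 1ℚ (k ℕ.* k) 1) ⟩
      2 × 1ℚ * ((k ℕ.* k) × 1ℚ + 1 × 1ℚ)     ≡⟨ cong (λ x → 2 × 1ℚ * (x + 1 × 1ℚ)) (×1-homo-* k k) ⟩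
      2 × 1ℚ * (k × 1ℚ * k × 1ℚ + 1 × 1ℚ)    ≡⟨ edges Q ⟩
      barbellTwiceEdges B B E                ∎
      where
      edges : ∀ Q → 2 × 1ℚ * ((1ℚ + (1ℚ + Q)) * (1ℚ + (1ℚ + Q)) + 1 × 1ℚ)
                  ≡ (1ℚ + Q) * (1ℚ + Q) + (1ℚ + Q) * (1ℚ + Q) + (1ℚ + Q) + (1ℚ + Q) + 2 × 1ℚ * (1ℚ + (Q + 2 × 1ℚ))
      edges = solve-∀ ℚ-ring

  identity : ∀ Q →
    let B  = 1ℚ + Q ; C = B ; E = 1ℚ + (Q + 2 × 1ℚ) ; N = (1ℚ + (1ℚ + Q)) * 3 × 1ℚ
        B₁ = 1ℚ + B ; C₁ = 1ℚ + C ; κ = B₁ * C₁ ; Dp = B + C + 2 × 1ℚ * E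
        LL = 2 × 1ℚ * C₁ * (B * B * B) * (B - 1ℚ)
        RR = 2 × 1ℚ * B₁ * (C * C * C) * (C - 1ℚ)
        LP = B * B * (2 × 1ℚ * C₁ * Dp + κ * (C₁ * E + E * (E - 1ℚ)))
        RP = C * C * (2 × 1ℚ * B₁ * Dp + κ * (B₁ * E + E * (E - 1ℚ)))
        LR = B * B * (C * C) * (2 × 1ℚ * C₁ + 2 × 1ℚ * B₁ + κ * E)
        PP = κ * (4 × 1ℚ * inv (3 × 1ℚ) * (E * (E + 1ℚ) * (E + 2 × 1ℚ)) + 2 × 1ℚ * (E * (E + 1ℚ)) * (B + C - 2 × 1ℚ)
                  + 2 × 1ℚ * ((B - 1ℚ) * (C - 1ℚ)) * E)
        X = N * (N * (N * 1 × 1ℚ)) + 3 × 1ℚ * (N * (N * 1 × 1ℚ)) + 60 × 1ℚ * N - ℕ→ℚ 270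
        Y = 297 × 1ℚ * (N * (N * 1 × 1ℚ)) - 729 × 1ℚ * N + ℕ→ℚ 5832
        H = N * (N * (N * 1 × 1ℚ)) + 9 × 1ℚ * N
    in (LL + RR + 2 × 1ℚ * (LP + RP + LR) + PP) * (ℕ→ℚ 54 * H)
       ≡ (B * B + C * C + B + C + 2 × 1ℚ * E) * (2 × 1ℚ * ((1ℚ + B) * (1ℚ + C))) * (X * H + Y)
  identity = solve-∀ ℚ-ring

corollary3p6 : (n : ℕ) → 6 ≤ n → 3 ∣ n →
    (m : Fin ((n / 3 Data.Nat.+ 2) Data.Nat.+ (n / 3 ∸ 1) Data.Nat.+ (n / 3 ∸ 1))
         → Fin ((n / 3 Data.Nat.+ 2) Data.Nat.+ (n / 3 ∸ 1) Data.Nat.+ (n / 3 ∸ 1)) → ℚ) →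
    IsHittingTimes (Barbell (n / 3 Data.Nat.+ 2) (n / 3 ∸ 1) (n / 3 ∸ 1)) m →
    ∀ i → kemenyFrom (Barbell (n / 3 Data.Nat.+ 2) (n / 3 ∸ 1) (n / 3 ∸ 1)) m i
      ≡ inv (ℕ→ℚ 54) *
        (ℕ→ℚ (n ^ 3) + ℕ→ℚ (3 Data.Nat.* n ^ 2) + ℕ→ℚ (60 Data.Nat.* n) - ℕ→ℚ 270
          + (ℕ→ℚ (297 Data.Nat.* n ^ 2) - ℕ→ℚ (729 Data.Nat.* n) + ℕ→ℚ 5832)
            * inv (ℕ→ℚ (n ^ 3 Data.Nat.+ 9 Data.Nat.* n)))
corollary3p6 n 6≤n 3∣n m hit i = begin
  kemenyFrom (Barbell (k ℕ.+ 2) (k ∸ 1) (k ∸ 1)) m i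
    ≡⟨ kemenyFrom-barbell (k ℕ.+ 2) (k ∸ 1) (k ∸ 1) (ℕP.m≤n+m 2 k) hit i ⟩
  barbellKemeny ((k ∸ 1) × 1ℚ) ((k ∸ 1) × 1ℚ) ((k ℕ.+ 2 ∸ 1) × 1ℚ)
    ≡⟨ barbellKemeny-corollary n k 6≤n (sym (m/n*n≡m 3∣n)) ⟩
  _ ∎
  where
  k = n / 3
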